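{- Let $n\ge1$, $S\subseteq[n-1]$ and $T=S\cup\{n\}$. Then the ($n$-dimensional Euclidean) volume of $P(\Delta[S,T])$ equals the number of maximal chains in the interval $[S,T]$ of the type $C_n$ Gale order, divided by $n!$.
   Context: Type $C_n$ Gale order on subsets of $[n]$: for $A=\{a_1<\dots<a_j\}$, $B=\{b_1<\dots<b_k\}$, $A\le B$ iff $j\le k$ and $a_{j-i+1}\le b_{k-i+1}$ for all $i\in[j]$. $[S,T]=\{A\subseteq[n]: S\le A\le T\}$. $\Delta[S,T]$ is the delta matroid on $[n]$ with feasible sets $[S,T]$, and $P(\Delta[S,T])=\operatorname{conv}\{e_R: R\in[S,T]\}\subseteq\mathbb{R}^n$, $e_R=\sum_{i\in R}e_i$. -}

module Defs where

open import Data.Bool using (Bool; true; false; if_then_else_)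
open import Data.Nat as ℕ using (ℕ; zero; suc; _^_; _!)

open import Data.Integer as ℤ using (ℤ; +_)
open import Data.Rational as ℚ using (ℚ; 0ℚ; 1ℚ; _+_; _*_; _-_; ∣_∣)
open import Data.Fin using (Fin)
open import Data.Fin.Subset using (Subset)
open import Data.Vec as Vec using (Vec; []; _∷_; lookup)
open import Data.List as List using (List; []; _∷_; _++_; map; reverse; length)
open import Data.List.Relation.Unary.All using (All)
open import Data.List.Relation.Unary.AllPairs using (AllPairs)
open import Data.List.Membership.Propositional using (_∈_)
open import Data.List.Relation.Unary.Unique.Propositional using (Unique)
open import Data.Product using (Σ; _×_; ∃; ∃-syntax)
open import Data.Unit using (⊤)
open import Data.Empty using (⊥)
open import Function.Bundles using (_⇔_)
open import Relation.Nullary using (¬_)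
open import Relation.Binary.PropositionalEquality using (_≡_)

-- A subset of [n] is a Subset n; position i : Fin n stands for the element (toℕ i + 1).

ascElems : ∀ {n} → Subset n → List ℕ
ascElems []            = []
ascElems (true  ∷ p) = 1 ∷ map suc (ascElems p)
ascElems (false ∷ p) = map suc (ascElems p)

descElems : ∀ {n} → Subset n → List ℕ
descElems A = reverse (ascElems A)

-- For decreasing lists (a_j, ..., a_1) and (b_k, ..., b_1):
-- j ≤ k and a_{j-i+1} ≤ b_{k-i+1} for all i ∈ [j].
GaleLists : List ℕ → List ℕ → Set
GaleLists []       _        = ⊤
GaleLists (x ∷ xs) []       = ⊥
GaleLists (x ∷ xs) (y ∷ ys) = (x ℕ.≤ y) × GaleLists xs ys

_≤G_ : ∀ {n} → Subset n → Subset n → Set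
A ≤G B = GaleLists (descElems A) (descElems B)

_<G_ : ∀ {n} → Subset n → Subset n → Set
A <G B = (A ≤G B) × ¬ (A ≡ B)
infix 4 _≤G_ _<G_

InInterval : ∀ {n} → Subset n → Subset n → Subset n → Set
InInterval S T A = (S ≤G A) × (A ≤G T)

-- A chain of [S,T], represented by the (unique) list of its elements in
-- strictly increasing Gale order.
IsChain : ∀ {n} → Subset n → Subset n → List (Subset n) → Set
IsChain S T C = All (InInterval S T) C × AllPairs _<G_ C

IsMaximalChain : ∀ {n : ℕ} → Subset n → Subset n → List (Subset n) → Set
IsMaximalChain {n} S T C =
  IsChain S T C ×
  ((C′ : List (Subset n)) → IsChain S T C′ →
     (∀ {A} → A ∈ C → A ∈ C′) → ∀ {A} → A ∈ C′ → A ∈ C)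

-- number of maximal chains of [S,T]: the length of a duplicate-free list
-- listing exactly the maximal chains
IsMaxChainEnumeration : ∀ {n : ℕ} → Subset n → Subset n → List (List (Subset n)) → Set
IsMaxChainEnumeration S T L =
  Unique L × (∀ C → (C ∈ L ⇔ IsMaximalChain S T C))

ℕtoℚ : ℕ → ℚ
ℕtoℚ k = (+ k) ℚ./ 1

ℤtoℚ : ℤ → ℚ
ℤtoℚ k = k ℚ./ 1

eCoord : ∀ {n} → Subset n → Fin n → ℚ
eCoord R i = if lookup R i then 1ℚ else 0ℚ

sumℚ : List ℚ → ℚ
sumℚ = List.foldr _+_ 0ℚ

-- x ∈ t·P(Δ[S,T]) : x = t · Σ λ_R e_R with λ_R ≥ 0, Σ λ_R = 1, R ∈ [S,T]
-- (a convex combination, given as a finite list of (R , λ_R)).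
InDilate : ∀ {n} → Subset n → Subset n → ℕ → Vec ℚ n → Set
InDilate {n} S T t x =
  ∃[ w ] (All (λ p → InInterval S T (Data.Product.proj₁ p)) w
        × All (λ p → 0ℚ ℚ.≤ Data.Product.proj₂ p) w
        × sumℚ (map Data.Product.proj₂ w) ≡ 1ℚ
        × (∀ (i : Fin n) → lookup x i ≡
             ℕtoℚ t * sumℚ (map (λ p → Data.Product.proj₂ p * eCoord (Data.Product.proj₁ p) i) w)))

IsLatticeEnumeration : ∀ {n : ℕ} → Subset n → Subset n → ℕ → List (Vec ℤ n) → Set
IsLatticeEnumeration S T t E =
  Unique E × (∀ x → (x ∈ E ⇔ InDilate S T t (Vec.map ℤtoℚ x)))

-- vol(P) = v, with the n-dimensional (Jordan) volume given by
--   v = lim_{t→∞} #(tP ∩ ℤⁿ) / tⁿ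
-- (stated without division: | #(tP ∩ ℤⁿ) - v·tⁿ | < ε·tⁿ ).
HasVolume : (n : ℕ) → Subset n → Subset n → ℚ → Set
HasVolume n S T v =
  (∀ (t : ℕ) → ∃[ E ] IsLatticeEnumeration S T t E)
  × (∀ (ε : ℚ) → 0ℚ ℚ.< ε → ∃[ t₀ ] ∀ (t : ℕ) → t₀ ℕ.≤ t → 1 ℕ.≤ t →
       ∀ (E : List (Vec ℤ n)) → IsLatticeEnumeration S T t E →
       ∣ ℕtoℚ (length E) - v * ℕtoℚ (t ^ n) ∣ ℚ.< ε * ℕtoℚ (t ^ n))

-- Write S′ = S ∷ʳ false and T′ = S ∷ʳ true. The Gale order compares, for every h, how many elements
-- of the two sets are at least h; so A ∈ [S′,T′] exactly when every suffix count of A exceeds that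
-- of S′ by a bit w_i, and these profiles w are the 0/1 vectors that weakly increase across the
-- positions of S and weakly decrease across the others. A ↦ w is an order isomorphism onto profiles
-- ordered by inclusion: [S′,T′] is the lattice of order ideals of a zigzag poset on n points, and its
-- maximal chains are the saturations, i.e. the orders in which the n positions can be added to the
-- empty profile one at a time while staying a profile. Likewise P(Δ[S′,T′]) is the unimodular image of the order polytope of that poset:
-- the lattice points of t P are the images of the height functions z : [n] → [0,t] with the same
-- monotonicity, z being the sum of the indicator vectors of its t level sets. Reading off the heights
-- along a saturation through all level sets of z puts the number of height functions between
-- e · #(strictly decreasing n-sequences in [0,t]) and e · #(weakly decreasing ones), where e is the
-- number of saturations; both are tⁿ/n! + O(tⁿ⁻¹), so the volume is e/n!.

module Submission where

open import Defs
open import Data.Bool using (Bool; true; false; T; _∧_; _∨_; not) renaming (_≤_ to _≤ᴮ_)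
open import Data.Bool.Base using (f≤t; b≤b)
import Data.Bool.Properties as Bool
open import Data.Empty using (⊥-elim)
open import Data.Fin using (Fin; zero; suc) renaming (_≟_ to _≟ᶠ_)
open import Data.Fin.Subset using (Subset; ∣_∣; _⊆_; _⊂_; _∩_; _∪_; ⋂; ⊤; ⊥) renaming (_∈_ to _∈ₛ_; _∉_ to _∉ₛ_)
open import Data.Fin.Subset.Properties using (_∈?_; _⊆?_; ∣⊤∣≡n; ∣⊥∣≡0; ∣p∣≡n⇒p≡⊤; p⊆q⇒∣p∣≤∣q∣; ∈⊤; ∉⊥; ⊆⊤; ⊥⊆; ⊆-refl; ⊆-reflexive; ⊆-trans; ⊆-antisym; ⊂-⊆-trans; ⊂-irref; s⊆s; out⊆; drop-∷-⊆; drop-there; p∩q⊆p; p∩q⊆q; x∈p∩q⁺; ∪-identityˡ; ∪-identityʳ)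
open import Data.Integer as ℤ using (ℤ; +_; -[1+_]; +≤+; +<+)
import Data.Integer.Properties as ℤ
open import Data.Integer.Solver using () renaming (module +-*-Solver to ℤ-Solver)
open import Data.List as List using (List; []; _∷_; [_]; map; reverse; length; filter; upTo; allFin; cartesianProductWith; cartesianProduct; _++_)
open import Data.List.Properties using (unfold-reverse; filter-accept; filter-reject; filter-none; filter-all; length-map; length-++; map-∘; ∷-injective; ∷-injectiveˡ; ∷-injectiveʳ)
open import Data.List.Membership.Propositional using (_∈_)
open import Data.List.Membership.Propositional.Properties using (∈-filter⁺; ∈-filter⁻; ∈-map⁺; ∈-map⁻; ∈-++⁺ˡ; ∈-++⁺ʳ; ∈-++⁻; ∈-∃++; ∈-allFin; ∈-upTo⁺; ∈-upTo⁻; ∈-cartesianProductWith⁺; ∈-cartesianProductWith⁻; ∈-cartesianProduct⁺; ∈-cartesianProduct⁻)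
open import Data.List.Relation.Binary.Permutation.Propositional using (↭-sym)
open import Data.List.Relation.Binary.Permutation.Propositional.Properties using (↭-length; filter-↭; ↭-reverse; All-resp-↭)
open import Data.List.Relation.Unary.All as All using (All; []; _∷_)
import Data.List.Relation.Unary.All.Properties as All
open import Data.List.Relation.Unary.AllPairs as AllPairs using (AllPairs; []; _∷_)
import Data.List.Relation.Unary.AllPairs.Properties as AllPairs
open import Data.List.Relation.Unary.Any using (here; there)
open import Data.List.Relation.Unary.Unique.Propositional using (Unique)
import Data.List.Relation.Unary.Unique.Propositional.Properties as Unique
open import Data.Nat as ℕ using (ℕ; zero; suc; _≤_; _<_; z≤n; s≤s; s≤s⁻¹; _+_; _*_; _^_; _!; _∸_; _≤?_; _≟_; _≤ᵇ_)
open import Data.Nat.Properties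
open import Data.Nat.Coprimality using (1-coprimeTo) renaming (sym to coprime-sym)
open import Data.Nat.Solver using () renaming (module +-*-Solver to ℕ-Solver)
import Data.Product as Product
open import Data.Product using (_×_; _,_; proj₁; proj₂; ∃-syntax; uncurry)
open import Data.Rational as ℚ using (ℚ; mkℚ; 0ℚ; 1ℚ; *≤*; *<*; ↥_; ↧ₙ_)
import Data.Rational.Properties as ℚ
open import Data.Rational.Unnormalised as ℚᵘ using (mkℚᵘ)
import Data.Sum as Sum
open import Data.Sum using (_⊎_; inj₁; inj₂)
open import Data.Unit using (tt) renaming (⊤ to Unit)
open import Data.Vec as Vec using (Vec; []; _∷_; _∷ʳ_; head; lookup; replicate; zipWith; _[_]≔_)
import Data.Vec.Properties as Vec
open import Data.Vec.Properties using (≡-dec; lookup-map; lookup-replicate; map-[]≔; map-replicate; lookup∘update; lookup∘update′; []≔-updates; []≔-minimal; []≔-lookup; []=⇒lookup; lookup⇒[]=; tabulate∘lookup; tabulate-cong)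
open import Function using (_∘_; flip; _⇔_; mk⇔; Equivalence)
open import Relation.Nullary using (¬_; Dec; yes; no; contradiction; ¬?; _×-dec_)
open import Relation.Binary.PropositionalEquality using (_≡_; _≢_; refl; sym; trans; cong; cong₂; subst; subst₂; module ≡-Reasoning)

WeaklyDecreasing StrictlyDecreasing : List ℕ → Set
WeaklyDecreasing   = AllPairs λ a b → b ≤ a
StrictlyDecreasing = AllPairs λ a b → b < a

module _ {A : Set} where

  AllPairs-∈⇒related : ∀ {R : A → A → Set} {xs x y} → AllPairs R xs → x ∈ xs → y ∈ xs → x ≢ y → R x y ⊎ R y x
  AllPairs-∈⇒related (_  ∷ _)   (here refl) (here refl) x≢y = contradiction refl x≢y
  AllPairs-∈⇒related (Rx ∷ _)   (here refl) (there y∈)  _   = inj₁ (All.lookup Rx y∈)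
  AllPairs-∈⇒related (Rx ∷ _)   (there x∈)  (here refl) _   = inj₂ (All.lookup Rx x∈)
  AllPairs-∈⇒related (_  ∷ Rxs) (there x∈)  (there y∈)  x≢y = AllPairs-∈⇒related Rxs x∈ y∈ x≢y

  AllPairs-mapᴾ : ∀ {P : A → Set} {R Q : A → A → Set} → (∀ {x y} → P x → P y → R x y → Q x y) →
                  ∀ {xs} → All P xs → AllPairs R xs → AllPairs Q xs
  AllPairs-mapᴾ f []         []         = []
  AllPairs-mapᴾ f (px ∷ pxs) (Rx ∷ Rxs) = All.zipWith (λ (py , r) → f px py r) (pxs , Rx) ∷ AllPairs-mapᴾ f pxs Rxs

  map-injectiveᴾ : ∀ {B : Set} {P : A → Set} {f : A → B} → (∀ {x y} → P x → P y → f x ≡ f y → x ≡ y) →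
                   ∀ {xs ys} → All P xs → All P ys → map f xs ≡ map f ys → xs ≡ ys
  map-injectiveᴾ inj {[]}     {[]}     _          _          _ = refl
  map-injectiveᴾ inj {x ∷ xs} {y ∷ ys} (px ∷ pxs) (py ∷ pys) e =
    cong₂ _∷_ (inj px py (∷-injectiveˡ e)) (map-injectiveᴾ inj pxs pys (∷-injectiveʳ e))

  Unique-map⁺ᴾ : ∀ {B : Set} {P : A → Set} {f : A → B} → (∀ {x y} → P x → P y → f x ≡ f y → x ≡ y) →
                 ∀ {xs} → All P xs → Unique xs → Unique (map f xs)
  Unique-map⁺ᴾ inj []         []         = []
  Unique-map⁺ᴾ inj (px ∷ pxs) (x∉ ∷ uxs) =
    All.map⁺ (All.zipWith (λ (py , x≢y) → x≢y ∘ inj px py) (pxs , x∉)) ∷ Unique-map⁺ᴾ inj pxs uxs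

  AllPairs-≡ : ∀ {R : A → A → Set} → (∀ {x} → ¬ R x x) → (∀ {x y} → R x y → ¬ R y x) →
               ∀ {xs ys} → AllPairs R xs → AllPairs R ys →
               (∀ {z} → z ∈ xs → z ∈ ys) → (∀ {z} → z ∈ ys → z ∈ xs) → xs ≡ ys
  AllPairs-≡ irr asym {[]}     {[]}     _ _ _ _ = refl
  AllPairs-≡ irr asym {[]}     {y ∷ ys} _ _ _ ys⊆ with ys⊆ (here refl)
  ... | ()
  AllPairs-≡ irr asym {x ∷ xs} {[]}     _ _ xs⊆ _ with xs⊆ (here refl)
  ... | ()
  AllPairs-≡ {R = R} irr asym {x ∷ xs} {y ∷ ys} (Rx ∷ Rxs) (Ry ∷ Rys) xs⊆ ys⊆ with heads
    where
    heads : x ≡ y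
    heads with xs⊆ (here refl) | ys⊆ (here refl)
    ... | here x≡y | _         = x≡y
    ... | there x∈ | here y≡x  = sym y≡x
    ... | there x∈ | there y∈  = contradiction (All.lookup Ry x∈) (asym (All.lookup Rx y∈))
  ... | refl = cong (x ∷_) (AllPairs-≡ irr asym Rxs Rys (tail Rx xs⊆) (tail Ry ys⊆))
    where
    tail : ∀ {us vs} → All (R x) us → (∀ {z} → z ∈ x ∷ us → z ∈ x ∷ vs) → ∀ {z} → z ∈ us → z ∈ vs
    tail Rx us⊆ z∈ with us⊆ (there z∈)
    ... | here refl = contradiction (All.lookup Rx z∈) irr
    ... | there z∈′ = z∈′

  Unique-⊆⇒length-≤ : ∀ {xs ys : List A} → Unique xs → (∀ {x} → x ∈ xs → x ∈ ys) → length xs ≤ length ys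
  Unique-⊆⇒length-≤ {[]}     _          _   = z≤n
  Unique-⊆⇒length-≤ {x ∷ xs} (x∉ ∷ uxs) xs⊆ with ∈-∃++ (xs⊆ (here refl))
  ... | us , vs , refl = subst (suc (length xs) ≤_) (sym length-split) (s≤s (Unique-⊆⇒length-≤ uxs xs⊆′))
    where
    length-split : length (us ++ x ∷ vs) ≡ suc (length (us ++ vs))
    length-split = trans (length-++ us) (trans (+-suc (length us) (length vs)) (cong suc (sym (length-++ us))))
    xs⊆′ : ∀ {y} → y ∈ xs → y ∈ us ++ vs
    xs⊆′ y∈ with ∈-++⁻ us (xs⊆ (there y∈))
    ... | inj₁ y∈us         = ∈-++⁺ˡ y∈us
    ... | inj₂ (here refl)  = contradiction refl (All.lookup x∉ y∈)
    ... | inj₂ (there y∈vs) = ∈-++⁺ʳ us y∈vs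

  listsOfLength : ℕ → List A → List (List A)
  listsOfLength zero    xs = [ [] ]
  listsOfLength (suc n) xs = cartesianProductWith _∷_ xs (listsOfLength n xs)

  listsOfLength-unique : ∀ n {xs} → Unique xs → Unique (listsOfLength n xs)
  listsOfLength-unique zero    _   = [] ∷ []
  listsOfLength-unique (suc n) uxs = Unique.cartesianProductWith⁺ _∷_ ∷-injective uxs (listsOfLength-unique n uxs)

  listsOfLength-complete : ∀ {xs} ys → All (_∈ xs) ys → ys ∈ listsOfLength (length ys) xs
  listsOfLength-complete []       []          = here refl
  listsOfLength-complete (y ∷ ys) (y∈ ∷ ys∈) = ∈-cartesianProductWith⁺ _∷_ y∈ (listsOfLength-complete ys ys∈)

AllPairs-reverse : ∀ {A : Set} {R : A → A → Set} {xs} → AllPairs R xs → AllPairs (flip R) (reverse xs)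
AllPairs-reverse {xs = []}     []         = []
AllPairs-reverse {xs = x ∷ xs} (Rx ∷ Rxs) = subst (AllPairs _) (sym (unfold-reverse x xs))
  (AllPairs.++⁺ (AllPairs-reverse Rxs) ([] ∷ [])
    (All.map (_∷ []) (All-resp-↭ (↭-sym (↭-reverse xs)) Rx)))

length-++-map : ∀ {A B : Set} (xs : List B) (f : A → B) ys → length (xs ++ map f ys) ≡ length xs + length ys
length-++-map xs f ys = trans (length-++ xs) (cong (_+_ (length xs)) (length-map f ys))

length-cartesianProductWith : ∀ {A B C : Set} (f : A → B → C) xs ys →
                              length (cartesianProductWith f xs ys) ≡ length xs * length ys
length-cartesianProductWith f []       ys = refl
length-cartesianProductWith f (x ∷ xs) ys =
  trans (length-++ (map (f x) ys)) (cong₂ _+_ (length-map (f x) ys) (length-cartesianProductWith f xs ys))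

toℕ : Bool → ℕ
toℕ false = 0
toℕ true  = 1

toℕ-mono : ∀ {a b} → a ≤ᴮ b → toℕ a ≤ toℕ b
toℕ-mono f≤t = z≤n
toℕ-mono b≤b = ≤-refl

toℕ-cancel : ∀ {a b} → toℕ a ≤ toℕ b → a ≤ᴮ b
toℕ-cancel {false} {false} _ = b≤b
toℕ-cancel {false} {true}  _ = f≤t
toℕ-cancel {true}  {true}  _ = b≤b
toℕ-cancel {true}  {false} ()

toℕ≤1 : ∀ a → toℕ a ≤ 1
toℕ≤1 false = z≤n
toℕ≤1 true  = ≤-refl

T⇒≤ᴮ : ∀ {a b} → (T a → T b) → a ≤ᴮ b
T⇒≤ᴮ {false} _ = Bool.≤-minimum _
T⇒≤ᴮ {true} {true}  _ = b≤b
T⇒≤ᴮ {true} {false} f = contradiction (f tt) λ ()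

≤ᴮ⇒T : ∀ {a b} → a ≤ᴮ b → T a → T b
≤ᴮ⇒T b≤b t = t

∧-mono-≤ : ∀ {a b c d} → a ≤ᴮ c → b ≤ᴮ d → a ∧ b ≤ᴮ c ∧ d
∧-mono-≤             f≤t _   = Bool.≤-minimum _
∧-mono-≤ {a = false} b≤b _   = b≤b
∧-mono-≤ {a = true}  b≤b b≤d = b≤d

≤ᵇ-false : ∀ {j v} → v < j → (j ≤ᵇ v) ≡ false
≤ᵇ-false {j} {v} v<j with j ≤ᵇ v in eq
... | false = refl
... | true  = contradiction (≤ᵇ⇒≤ j v (subst T (sym eq) tt)) (<⇒≱ v<j)

≤ᵇ-true : ∀ {j v} → j ≤ v → (j ≤ᵇ v) ≡ true
≤ᵇ-true j≤v = Equivalence.to Bool.T-≡ (≤⇒≤ᵇ j≤v)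

≤ᵇ-mono : ∀ j {x y} → x ≤ y → (j ≤ᵇ x) ≤ᴮ (j ≤ᵇ y)
≤ᵇ-mono j {x} x≤y = T⇒≤ᴮ λ j≤x → ≤⇒≤ᵇ (≤-trans (≤ᵇ⇒≤ j x j≤x) x≤y)

≤ᵇ-reflect : ∀ {x y} → (∀ j → (suc j ≤ᵇ x) ≤ᴮ (suc j ≤ᵇ y)) → x ≤ y
≤ᵇ-reflect {zero}  _ = z≤n
≤ᵇ-reflect {suc x} {y} h = ≤ᵇ⇒≤ (suc x) y (≤ᴮ⇒T (h x) (≤⇒≤ᵇ (≤-refl {suc x})))

∣∷∣ : ∀ {k} a (p : Subset k) → ∣ a ∷ p ∣ ≡ toℕ a + ∣ p ∣
∣∷∣ true  p = refl
∣∷∣ false p = refl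

∷-⊆ : ∀ {k a b} {p q : Subset k} → a ≤ᴮ b → p ⊆ q → a ∷ p ⊆ b ∷ q
∷-⊆ f≤t p⊆q = out⊆ p⊆q
∷-⊆ b≤b p⊆q = s⊆s p⊆q

⊆-head : ∀ {k a b} {p q : Subset k} → a ∷ p ⊆ b ∷ q → a ≤ᴮ b
⊆-head {a = false} {false} _ = b≤b
⊆-head {a = false} {true}  _ = f≤t
⊆-head {a = true}          sub with sub Vec.here
... | Vec.here = b≤b

insert : ∀ {n} → Fin n → Subset n → Subset n
insert k p = p [ k ]≔ true

∈-insert : ∀ {n} (k : Fin n) p → k ∈ₛ insert k p
∈-insert k p = []≔-updates p k

insert-⊇ : ∀ {n} {k : Fin n} {p} → p ⊆ insert k p
insert-⊇ {k = k} {p} {x} x∈p with x ≟ᶠ k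
... | yes refl = ∈-insert k p
... | no x≢k   = []≔-minimal p x k x≢k x∈p

∈-insert⁻ : ∀ {n} {k x : Fin n} {p} → x ∈ₛ insert k p → x ≢ k → x ∈ₛ p
∈-insert⁻ {k = k} {x} {p} x∈ x≢k = lookup⇒[]= x p (trans (sym (lookup∘update′ x≢k p true)) ([]=⇒lookup x∈))

insert-⊆ : ∀ {n} {k : Fin n} {p q} → p ⊆ q → k ∈ₛ q → insert k p ⊆ q
insert-⊆ {k = k} p⊆q k∈q {x} x∈ with x ≟ᶠ k
... | yes refl = k∈q
... | no x≢k   = p⊆q (∈-insert⁻ x∈ x≢k)

insert-⊂ : ∀ {n} {k : Fin n} {p} → k ∉ₛ p → p ⊂ insert k p
insert-⊂ {k = k} {p} k∉p = insert-⊇ , k , ∈-insert k p , k∉p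

∣insert∣ : ∀ {n} (k : Fin n) p → k ∉ₛ p → ∣ insert k p ∣ ≡ suc ∣ p ∣
∣insert∣ zero    (false ∷ p) _   = refl
∣insert∣ zero    (true ∷ p)  k∉p = contradiction Vec.here k∉p
∣insert∣ (suc k) (a ∷ p)     k∉p = trans (∣∷∣ a (insert k p))
  (trans (cong (_+_ (toℕ a)) (∣insert∣ k p (k∉p ∘ Vec.there))) (trans (+-suc (toℕ a) ∣ p ∣) (cong suc (sym (∣∷∣ a p)))))

⊆-∣∣-≡ : ∀ {n} {p q : Subset n} → p ⊆ q → ∣ p ∣ ≡ ∣ q ∣ → p ≡ q
⊆-∣∣-≡ {p = []}        {[]}        _   _ = refl
⊆-∣∣-≡ {p = false ∷ p} {false ∷ q} p⊆q e = cong (false ∷_) (⊆-∣∣-≡ (drop-∷-⊆ p⊆q) e)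
⊆-∣∣-≡ {p = false ∷ p} {true ∷ q}  p⊆q e =
  contradiction (p⊆q⇒∣p∣≤∣q∣ (drop-∷-⊆ p⊆q)) (subst (λ x → ¬ x ≤ ∣ q ∣) (sym e) 1+n≰n)
⊆-∣∣-≡ {p = true ∷ p}  {true ∷ q}  p⊆q e = cong (true ∷_) (⊆-∣∣-≡ (drop-∷-⊆ p⊆q) (suc-injective e))
⊆-∣∣-≡ {p = true ∷ p}  {false ∷ q} p⊆q e = contradiction (⊆-head p⊆q) λ ()

⊆∧≢⇒∣∣< : ∀ {n} {p q : Subset n} → p ⊆ q → p ≢ q → ∣ p ∣ < ∣ q ∣
⊆∧≢⇒∣∣< p⊆q p≢q with m≤n⇒m<n∨m≡n (p⊆q⇒∣p∣≤∣q∣ p⊆q)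
... | inj₁ lt = lt
... | inj₂ eq = contradiction (⊆-∣∣-≡ p⊆q eq) p≢q

insert-∪ : ∀ {n} (k : Fin n) x w → insert k x ∪ w ≡ x ∪ insert k w
insert-∪ zero    (a ∷ x) (b ∷ w) = cong (_∷ (x ∪ w)) (sym (Bool.∨-zeroʳ a))
insert-∪ (suc k) (a ∷ x) (b ∷ w) = cong ((a ∨ b) ∷_) (insert-∪ k x w)

_≟ˢ_ : ∀ {n} (p q : Subset n) → Dec (p ≡ q)
_≟ˢ_ = ≡-dec Bool._≟_

Comparable : ∀ {n} → Subset n → Subset n → Set
Comparable p q = p ⊆ q ⊎ q ⊆ p

comparable-sym : ∀ {n} {p q : Subset n} → Comparable p q → Comparable q p
comparable-sym = Sum.swap

⊥-comparable : ∀ {n} (p : Subset n) → Comparable ⊥ p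
⊥-comparable p = inj₁ ⊥⊆

comparable-⊈ : ∀ {n} {p q : Subset n} → Comparable p q → ¬ q ⊆ p → p ⊆ q
comparable-⊈ (inj₁ p⊆q) _   = p⊆q
comparable-⊈ (inj₂ q⊆p) q⊈p = ⊥-elim (q⊈p q⊆p)

∩-absorbˡ : ∀ {n} {p q : Subset n} → p ⊆ q → p ∩ q ≡ p
∩-absorbˡ {p = p} {q} p⊆q = ⊆-antisym (p∩q⊆p p q) (λ x∈p → x∈p∩q⁺ (x∈p , p⊆q x∈p))

∩-absorbʳ : ∀ {n} {p q : Subset n} → q ⊆ p → p ∩ q ≡ q
∩-absorbʳ {p = p} {q} q⊆p = ⊆-antisym (p∩q⊆q p q) (λ x∈q → x∈p∩q⁺ (q⊆p x∈q , x∈q))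

⋂-⊆ : ∀ {n} {ps : List (Subset n)} {p} → p ∈ ps → ⋂ ps ⊆ p
⋂-⊆ {ps = q ∷ ps} (here refl) = p∩q⊆p q (⋂ ps)
⋂-⊆ {ps = q ∷ ps} (there p∈)  = ⊆-trans (p∩q⊆q q (⋂ ps)) (⋂-⊆ p∈)

⊆-⋂ : ∀ {n} {x : Subset n} {ps} → All (x ⊆_) ps → x ⊆ ⋂ ps
⊆-⋂ []              = ⊆⊤
⊆-⋂ (x⊆p ∷ x⊆⋂ps) y∈x = x∈p∩q⁺ (x⊆p y∈x , ⊆-⋂ x⊆⋂ps y∈x)

⋂-chain-∈ : ∀ {n} t (ts : List (Subset n)) → AllPairs Comparable (t ∷ ts) → ⋂ (t ∷ ts) ∈ t ∷ ts
⋂-chain-∈ t []        _        = here (∩-absorbˡ ⊆⊤)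
⋂-chain-∈ t (t₂ ∷ ts) (c ∷ cs) with ⋂-chain-∈ t₂ ts cs
... | m∈ with All.lookup c m∈
...   | inj₁ t⊆m = here (∩-absorbˡ t⊆m)
...   | inj₂ m⊆t = there (subst (_∈ t₂ ∷ ts) (sym (∩-absorbʳ m⊆t)) m∈)

-- Zigzag vectors

Step : ∀ {A : Set} → (A → A → Set) → Bool → A → A → Set
Step _R_ true  x y = x R y
Step _R_ false x y = y R x

Zigzag : ∀ {A : Set} {m} → (A → A → Set) → Subset m → Vec A (suc m) → Set
Zigzag R []      (_ ∷ [])    = Unit
Zigzag R (s ∷ S) (x ∷ y ∷ w) = Step R s x y × Zigzag R S (y ∷ w)

Step-refl : ∀ {A : Set} {R : A → A → Set} → (∀ {x} → R x x) → ∀ s {x} → Step R s x x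
Step-refl r true  = r
Step-refl r false = r

Zigzag-replicate : ∀ {A : Set} {R : A → A → Set} → (∀ {x} → R x x) → ∀ {m} (S : Subset m) x →
                   Zigzag R S (replicate (suc m) x)
Zigzag-replicate r []      x = tt
Zigzag-replicate r (s ∷ S) x = Step-refl r s , Zigzag-replicate r S x

Zigzag-zipWith : ∀ {A : Set} {R : A → A → Set} {f : A → A → A} →
                 (∀ {a b c d} → R a c → R b d → R (f a b) (f c d)) →
                 ∀ {m} (S : Subset m) {w u} → Zigzag R S w → Zigzag R S u → Zigzag R S (zipWith f w u)
Zigzag-zipWith f-mono []          {_ ∷ []}    {_ ∷ []}    _         _         = tt
Zigzag-zipWith f-mono (true ∷ S)  {_ ∷ _ ∷ _} {_ ∷ _ ∷ _} (sw , zw) (su , zu) = f-mono sw su , Zigzag-zipWith f-mono S zw zu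
Zigzag-zipWith f-mono (false ∷ S) {_ ∷ _ ∷ _} {_ ∷ _ ∷ _} (sw , zw) (su , zu) = f-mono sw su , Zigzag-zipWith f-mono S zw zu

Step-map : ∀ {A B : Set} {R : A → A → Set} {R′ : B → B → Set} {f : A → B} → (∀ {x y} → R x y → R′ (f x) (f y)) →
           ∀ s {x y} → Step R s x y → Step R′ s (f x) (f y)
Step-map f-mono true  = f-mono
Step-map f-mono false = f-mono

Zigzag-map : ∀ {A B : Set} {R : A → A → Set} {R′ : B → B → Set} {f : A → B} → (∀ {x y} → R x y → R′ (f x) (f y)) →
             ∀ {m} (S : Subset m) {w} → Zigzag R S w → Zigzag R′ S (Vec.map f w)
Zigzag-map f-mono []      {_ ∷ []}    _         = tt
Zigzag-map f-mono (s ∷ S) {_ ∷ _ ∷ _} (st , zw) = Step-map f-mono s st , Zigzag-map f-mono S zw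

Zigzag-reflect : ∀ {A B I : Set} {R : A → A → Set} {R′ : B → B → Set} {f : I → A → B} →
                 (∀ {x y} → (∀ j → R′ (f j x) (f j y)) → R x y) →
                 ∀ {m} (S : Subset m) {w} → (∀ j → Zigzag R′ S (Vec.map (f j) w)) → Zigzag R S w
Zigzag-reflect f-refl []          {_ ∷ []}    _  = tt
Zigzag-reflect f-refl (true ∷ S)  {_ ∷ _ ∷ _} zs = f-refl (proj₁ ∘ zs) , Zigzag-reflect f-refl S (proj₂ ∘ zs)
Zigzag-reflect f-refl (false ∷ S) {_ ∷ _ ∷ _} zs = f-refl (proj₁ ∘ zs) , Zigzag-reflect f-refl S (proj₂ ∘ zs)

Step? : ∀ {A : Set} {R : A → A → Set} → (∀ x y → Dec (R x y)) → ∀ s x y → Dec (Step R s x y)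
Step? R? true  x y = R? x y
Step? R? false x y = R? y x

zigzag? : ∀ {A : Set} {R : A → A → Set} → (∀ x y → Dec (R x y)) → ∀ {m} (S : Subset m) w → Dec (Zigzag R S w)
zigzag? R? []      (_ ∷ [])    = yes tt
zigzag? R? (s ∷ S) (x ∷ y ∷ w) = Step? R? s x y ×-dec zigzag? R? S (y ∷ w)

-- The Gale order as dominance of suffix counts

countAtLeast : ℕ → List ℕ → ℕ
countAtLeast h xs = length (filter (h ≤?_) xs)

countAtLeast-reverse : ∀ h xs → countAtLeast h (reverse xs) ≡ countAtLeast h xs
countAtLeast-reverse h xs = ↭-length (filter-↭ (h ≤?_) (↭-reverse xs))

countAtLeast-accept : ∀ {h x} xs → h ≤ x → countAtLeast h (x ∷ xs) ≡ suc (countAtLeast h xs)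
countAtLeast-accept xs h≤x = cong length (filter-accept (_ ≤?_) h≤x)

countAtLeast-reject : ∀ {h x} xs → ¬ h ≤ x → countAtLeast h (x ∷ xs) ≡ countAtLeast h xs
countAtLeast-reject xs h≰x = cong length (filter-reject (_ ≤?_) h≰x)

countAtLeast-below : ∀ {h xs} → All (_< h) xs → countAtLeast h xs ≡ 0
countAtLeast-below xs<h = cong length (filter-none (_ ≤?_) (All.map <⇒≱ xs<h))

countAtLeast-zero : ∀ xs → countAtLeast 0 xs ≡ length xs
countAtLeast-zero xs = cong length (filter-all (0 ≤?_) (All.universal (λ _ → z≤n) xs))

countAtLeast-map-suc : ∀ h xs → countAtLeast (suc h) (map suc xs) ≡ countAtLeast h xs
countAtLeast-map-suc h [] = refl
countAtLeast-map-suc h (x ∷ xs) with h ≤? x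
... | yes h≤x = trans (countAtLeast-accept (map suc xs) (s≤s h≤x))
                      (trans (cong suc (countAtLeast-map-suc h xs)) (sym (countAtLeast-accept xs h≤x)))
... | no h≰x  = trans (countAtLeast-reject (map suc xs) (λ h≤x → h≰x (s≤s⁻¹ h≤x)))
                      (trans (countAtLeast-map-suc h xs) (sym (countAtLeast-reject xs h≰x)))

GaleLists⇒countAtLeast-≤ : ∀ {xs ys} → GaleLists xs ys → ∀ h → countAtLeast h xs ≤ countAtLeast h ys
GaleLists⇒countAtLeast-≤ {[]}               _         h = z≤n
GaleLists⇒countAtLeast-≤ {x ∷ xs} {y ∷ ys} (x≤y , g) h with h ≤? x | h ≤? y
... | yes h≤x | yes h≤y = subst₂ _≤_ (sym (countAtLeast-accept xs h≤x)) (sym (countAtLeast-accept ys h≤y))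
                                  (s≤s (GaleLists⇒countAtLeast-≤ g h))
... | yes h≤x | no h≰y  = contradiction (≤-trans h≤x x≤y) h≰y
... | no h≰x  | yes h≤y = subst₂ _≤_ (sym (countAtLeast-reject xs h≰x)) (sym (countAtLeast-accept ys h≤y))
                                  (m≤n⇒m≤1+n (GaleLists⇒countAtLeast-≤ g h))
... | no h≰x  | no h≰y  = subst₂ _≤_ (sym (countAtLeast-reject xs h≰x)) (sym (countAtLeast-reject ys h≰y))
                                  (GaleLists⇒countAtLeast-≤ g h)

countAtLeast-≤⇒GaleLists : ∀ {xs ys} → StrictlyDecreasing xs → StrictlyDecreasing ys →
                           (∀ h → countAtLeast h xs ≤ countAtLeast h ys) → GaleLists xs ys
countAtLeast-≤⇒GaleLists {[]}          _ _ _ = tt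
countAtLeast-≤⇒GaleLists {x ∷ xs} {[]} _ _ c with c x
... | x≤0 rewrite countAtLeast-accept xs (≤-refl {x}) = contradiction x≤0 λ ()
countAtLeast-≤⇒GaleLists {x ∷ xs} {y ∷ ys} (x>xs ∷ dxs) (y>ys ∷ dys) c = x≤y , countAtLeast-≤⇒GaleLists dxs dys c′
  where
  x≤y : x ≤ y
  x≤y with x ≤? y
  ... | yes x≤y = x≤y
  ... | no x≰y = contradiction (c x)
    (<⇒≱ (subst₂ _<_ (sym (countAtLeast-below y∷ys<x)) (sym (countAtLeast-accept {x} xs ≤-refl)) (s≤s z≤n)))
    where
    y∷ys<x : All (_< x) (y ∷ ys)
    y∷ys<x = ≰⇒> x≰y ∷ All.map (λ z<y → <-trans z<y (≰⇒> x≰y)) y>ys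
  c′ : ∀ h → countAtLeast h xs ≤ countAtLeast h ys
  c′ h with h ≤? x
  ... | yes h≤x = s≤s⁻¹ (subst₂ _≤_ (countAtLeast-accept xs h≤x) (countAtLeast-accept ys (≤-trans h≤x x≤y)) (c h))
  ... | no h≰x  = subst (_≤ countAtLeast h ys) (sym (countAtLeast-below (All.map (λ z<x → <-trans z<x (≰⇒> h≰x)) x>xs))) z≤n

ascElems-positive : ∀ {k} (p : Subset k) → All (0 <_) (ascElems p)
ascElems-positive []          = []
ascElems-positive (true ∷ p)  = s≤s z≤n ∷ All.map⁺ (All.universal (λ _ → s≤s z≤n) (ascElems p))
ascElems-positive (false ∷ p) = All.map⁺ (All.universal (λ _ → s≤s z≤n) (ascElems p))

ascElems-increasing : ∀ {k} (p : Subset k) → AllPairs _<_ (ascElems p)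
ascElems-increasing []          = []
ascElems-increasing (true ∷ p)  =
  All.map⁺ (All.map s≤s (ascElems-positive p)) ∷ AllPairs.map⁺ (AllPairs.map s≤s (ascElems-increasing p))
ascElems-increasing (false ∷ p) = AllPairs.map⁺ (AllPairs.map s≤s (ascElems-increasing p))

descElems-descending : ∀ {k} (p : Subset k) → StrictlyDecreasing (descElems p)
descElems-descending p = AllPairs-reverse (ascElems-increasing p)

length-ascElems : ∀ {k} (p : Subset k) → length (ascElems p) ≡ ∣ p ∣
length-ascElems []          = refl
length-ascElems (true ∷ p)  = cong suc (trans (length-map suc (ascElems p)) (length-ascElems p))
length-ascElems (false ∷ p) = trans (length-map suc (ascElems p)) (length-ascElems p)

countAtLeast-0-ascElems : ∀ {k} (p : Subset k) → countAtLeast 0 (ascElems p) ≡ ∣ p ∣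
countAtLeast-0-ascElems p = trans (countAtLeast-zero (ascElems p)) (length-ascElems p)

countAtLeast-1-ascElems : ∀ {k} (p : Subset k) → countAtLeast 1 (ascElems p) ≡ ∣ p ∣
countAtLeast-1-ascElems []          = refl
countAtLeast-1-ascElems (true ∷ p)  = trans (countAtLeast-accept (map suc (ascElems p)) (≤-refl {1}))
  (cong suc (trans (countAtLeast-map-suc 0 (ascElems p)) (countAtLeast-0-ascElems p)))
countAtLeast-1-ascElems (false ∷ p) = trans (countAtLeast-map-suc 0 (ascElems p)) (countAtLeast-0-ascElems p)

countAtLeast-2+-ascElems : ∀ {k} h a (p : Subset k) →
                           countAtLeast (suc (suc h)) (ascElems (a ∷ p)) ≡ countAtLeast (suc h) (ascElems p)
countAtLeast-2+-ascElems h true  p = trans (countAtLeast-reject {x = 1} (map suc (ascElems p)) λ { (s≤s ()) })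
                                           (countAtLeast-map-suc (suc h) (ascElems p))
countAtLeast-2+-ascElems h false p = countAtLeast-map-suc (suc h) (ascElems p)

infix 4 _≼_

_≼_ : ∀ {k} → Subset k → Subset k → Set
[]      ≼ []      = Unit
(a ∷ p) ≼ (b ∷ q) = ∣ a ∷ p ∣ ≤ ∣ b ∷ q ∣ × p ≼ q

≼-∣∣ : ∀ {k} {p q : Subset k} → p ≼ q → ∣ p ∣ ≤ ∣ q ∣
≼-∣∣ {p = []}    {[]}    _       = z≤n
≼-∣∣ {p = _ ∷ _} {_ ∷ _} (d , _) = d

SuffixCounts-≤ : ∀ {k} → Subset k → Subset k → Set
SuffixCounts-≤ p q = ∀ h → countAtLeast h (ascElems p) ≤ countAtLeast h (ascElems q)

SuffixCounts-≤⇒≼ : ∀ {k} (p q : Subset k) → SuffixCounts-≤ p q → p ≼ q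
SuffixCounts-≤⇒≼ []      []      _ = tt
SuffixCounts-≤⇒≼ (a ∷ p) (b ∷ q) c =
  subst₂ _≤_ (countAtLeast-1-ascElems (a ∷ p)) (countAtLeast-1-ascElems (b ∷ q)) (c 1) , SuffixCounts-≤⇒≼ p q c′
  where
  c′ : SuffixCounts-≤ p q
  c′ zero    = subst₂ _≤_ (trans (countAtLeast-2+-ascElems 0 a p) (trans (countAtLeast-1-ascElems p) (sym (countAtLeast-0-ascElems p))))
                          (trans (countAtLeast-2+-ascElems 0 b q) (trans (countAtLeast-1-ascElems q) (sym (countAtLeast-0-ascElems q))))
                          (c 2)
  c′ (suc h) = subst₂ _≤_ (countAtLeast-2+-ascElems h a p) (countAtLeast-2+-ascElems h b q) (c (suc (suc h)))

≼⇒SuffixCounts-≤ : ∀ {k} (p q : Subset k) → p ≼ q → SuffixCounts-≤ p q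
≼⇒SuffixCounts-≤ []      []      _        h             = z≤n
≼⇒SuffixCounts-≤ (a ∷ p) (b ∷ q) (d , _)  zero          =
  subst₂ _≤_ (sym (countAtLeast-0-ascElems (a ∷ p))) (sym (countAtLeast-0-ascElems (b ∷ q))) d
≼⇒SuffixCounts-≤ (a ∷ p) (b ∷ q) (d , _)  (suc zero)    =
  subst₂ _≤_ (sym (countAtLeast-1-ascElems (a ∷ p))) (sym (countAtLeast-1-ascElems (b ∷ q))) d
≼⇒SuffixCounts-≤ (a ∷ p) (b ∷ q) (_ , ds) (suc (suc h)) =
  subst₂ _≤_ (sym (countAtLeast-2+-ascElems h a p)) (sym (countAtLeast-2+-ascElems h b q)) (≼⇒SuffixCounts-≤ p q ds (suc h))

≤G⇔≼ : ∀ {k} (p q : Subset k) → p ≤G q ⇔ p ≼ q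
≤G⇔≼ p q = mk⇔
  (λ p≤q → SuffixCounts-≤⇒≼ p q λ h → subst₂ _≤_ (countAtLeast-reverse h (ascElems p)) (countAtLeast-reverse h (ascElems q))
                                          (GaleLists⇒countAtLeast-≤ p≤q h))
  (λ p≼q → countAtLeast-≤⇒GaleLists (descElems-descending p) (descElems-descending q) λ h →
             subst₂ _≤_ (sym (countAtLeast-reverse h (ascElems p))) (sym (countAtLeast-reverse h (ascElems q)))
                    (≼⇒SuffixCounts-≤ p q p≼q h))

≼-refl : ∀ {k} (p : Subset k) → p ≼ p
≼-refl []      = tt
≼-refl (a ∷ p) = ≤-refl , ≼-refl p

≼-antisym : ∀ {k} {p q : Subset k} → p ≼ q → q ≼ p → p ≡ q
≼-antisym {p = []}    {[]}    _        _          = refl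
≼-antisym {p = a ∷ p} {b ∷ q} (d , ds) (d′ , ds′) with ≼-antisym ds ds′
... | refl = cong (_∷ p) (Bool.≤-antisym (toℕ-cancel (≤-reflexive toℕ-a≡b)) (toℕ-cancel (≤-reflexive (sym toℕ-a≡b))))
  where
  toℕ-a≡b : toℕ a ≡ toℕ b
  toℕ-a≡b = +-cancelʳ-≡ ∣ p ∣ (toℕ a) (toℕ b) (trans (sym (∣∷∣ a p)) (trans (≤-antisym d d′) (∣∷∣ b p)))

≤G-refl : ∀ {k} (p : Subset k) → p ≤G p
≤G-refl p = Equivalence.from (≤G⇔≼ p p) (≼-refl p)

<G-irrefl : ∀ {k} {p : Subset k} → ¬ p <G p
<G-irrefl (_ , p≢p) = p≢p refl

<G-asym : ∀ {k} {p q : Subset k} → p <G q → ¬ q <G p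
<G-asym {p = p} {q} (p≤q , p≢q) (q≤p , _) =
  p≢q (≼-antisym (Equivalence.to (≤G⇔≼ p q) p≤q) (Equivalence.to (≤G⇔≼ q p) q≤p))

chain-≤G-total : ∀ {k} {C : List (Subset k)} → AllPairs _<G_ C → ∀ {p q} → p ∈ C → q ∈ C → p ≤G q ⊎ q ≤G p
chain-≤G-total C< {p} {q} p∈ q∈ with p ≟ˢ q
... | yes refl = inj₁ (≤G-refl p)
... | no p≢q   = Sum.map proj₁ proj₁ (AllPairs-∈⇒related C< p∈ q∈ p≢q)

-- Profiles: the interval [S ∷ʳ false , S ∷ʳ true] as a lattice of subsets

Profile : ∀ {m} → Subset m → Subset (suc m) → Set
Profile = Zigzag _≤ᴮ_

∣∷ʳtrue∣ : ∀ {m} (S : Subset m) → ∣ S ∷ʳ true ∣ ≡ suc ∣ S ∷ʳ false ∣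
∣∷ʳtrue∣ []      = refl
∣∷ʳtrue∣ (s ∷ S) = begin
  ∣ (s ∷ S) ∷ʳ true ∣            ≡⟨ ∣∷∣ s (S ∷ʳ true) ⟩
  toℕ s + ∣ S ∷ʳ true ∣          ≡⟨ cong (_+_ (toℕ s)) (∣∷ʳtrue∣ S) ⟩
  toℕ s + suc ∣ S ∷ʳ false ∣     ≡⟨ +-suc (toℕ s) _ ⟩
  suc (toℕ s + ∣ S ∷ʳ false ∣)   ≡⟨ cong suc (sym (∣∷∣ s (S ∷ʳ false))) ⟩
  suc ∣ (s ∷ S) ∷ʳ false ∣       ∎
  where open ≡-Reasoning

-- The i-th entry is s_i + w_i - w_(i+1), so that the suffix counts of fromProfile S w exceed
-- those of S ∷ʳ false by w.
entry : Bool → Bool → Bool → Bool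
entry true  a b = a ∨ not b
entry false a b = a ∧ not b

fromProfile : ∀ {m} → Subset m → Subset (suc m) → Subset (suc m)
fromProfile []      (w ∷ [])      = w ∷ []
fromProfile (s ∷ S) (w₁ ∷ w₂ ∷ w) = entry s w₁ w₂ ∷ fromProfile S (w₂ ∷ w)

entry-balance : ∀ s {a b} → Step _≤ᴮ_ s a b → toℕ (entry s a b) + toℕ b ≡ toℕ s + toℕ a
entry-balance true  {false} f≤t = refl
entry-balance true  {false} b≤b = refl
entry-balance true  {true}  b≤b = refl
entry-balance false {false} b≤b = refl
entry-balance false {true}  f≤t = refl
entry-balance false {true}  b≤b = refl

∣fromProfile∣ : ∀ {m} (S : Subset m) {w} → Profile S w → ∣ fromProfile S w ∣ ≡ toℕ (head w) + ∣ S ∷ʳ false ∣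
∣fromProfile∣ []      {false ∷ []} _ = refl
∣fromProfile∣ []      {true ∷ []}  _ = refl
∣fromProfile∣ (s ∷ S) {w₁ ∷ w₂ ∷ w} (st , zw) = begin
  ∣ entry s w₁ w₂ ∷ fromProfile S (w₂ ∷ w) ∣    ≡⟨ ∣∷∣ (entry s w₁ w₂) (fromProfile S (w₂ ∷ w)) ⟩
  toℕ (entry s w₁ w₂) + ∣ fromProfile S (w₂ ∷ w) ∣ ≡⟨ cong (_+_ (toℕ (entry s w₁ w₂))) (∣fromProfile∣ S zw) ⟩
  toℕ (entry s w₁ w₂) + (toℕ w₂ + c)            ≡⟨ sym (+-assoc (toℕ (entry s w₁ w₂)) _ c) ⟩
  toℕ (entry s w₁ w₂) + toℕ w₂ + c              ≡⟨ cong (_+ c) (entry-balance s st) ⟩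
  toℕ s + toℕ w₁ + c                            ≡⟨ cong (_+ c) (+-comm (toℕ s) (toℕ w₁)) ⟩
  toℕ w₁ + toℕ s + c                            ≡⟨ +-assoc (toℕ w₁) (toℕ s) c ⟩
  toℕ w₁ + (toℕ s + c)                          ≡⟨ cong (_+_ (toℕ w₁)) (sym (∣∷∣ s (S ∷ʳ false))) ⟩
  toℕ w₁ + ∣ (s ∷ S) ∷ʳ false ∣                 ∎
  where
  open ≡-Reasoning
  c = ∣ S ∷ʳ false ∣

S′≤∣fromProfile∣ : ∀ {m} (S : Subset m) {w} → Profile S w → ∣ S ∷ʳ false ∣ ≤ ∣ fromProfile S w ∣
S′≤∣fromProfile∣ S {w} zw = subst (_ ≤_) (sym (∣fromProfile∣ S zw)) (m≤n+m _ (toℕ (head w)))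

∣fromProfile∣≤T′ : ∀ {m} (S : Subset m) {w} → Profile S w → ∣ fromProfile S w ∣ ≤ ∣ S ∷ʳ true ∣
∣fromProfile∣≤T′ S {w} zw = subst₂ _≤_ (sym (∣fromProfile∣ S zw)) (sym (∣∷ʳtrue∣ S)) (+-monoˡ-≤ _ (toℕ≤1 (head w)))

S′≼fromProfile : ∀ {m} (S : Subset m) {w} → Profile S w → S ∷ʳ false ≼ fromProfile S w
S′≼fromProfile []      {w@(_ ∷ [])}    zw        = S′≤∣fromProfile∣ [] {w} zw , tt
S′≼fromProfile (s ∷ S) {w@(_ ∷ _ ∷ _)} (st , zw) = S′≤∣fromProfile∣ (s ∷ S) {w} (st , zw) , S′≼fromProfile S zw

fromProfile≼T′ : ∀ {m} (S : Subset m) {w} → Profile S w → fromProfile S w ≼ S ∷ʳ true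
fromProfile≼T′ []      {w@(_ ∷ [])}    zw        = ∣fromProfile∣≤T′ [] {w} zw , tt
fromProfile≼T′ (s ∷ S) {w@(_ ∷ _ ∷ _)} (st , zw) = ∣fromProfile∣≤T′ (s ∷ S) {w} (st , zw) , fromProfile≼T′ S zw

module _ {m} (S : Subset m) {w u : Subset (suc m)} (zw : Profile S w) (zu : Profile S u) where

  ∣fromProfile∣-≤⇔head-≤ : ∣ fromProfile S w ∣ ≤ ∣ fromProfile S u ∣ ⇔ head w ≤ᴮ head u
  ∣fromProfile∣-≤⇔head-≤ = mk⇔
    (λ d → toℕ-cancel (+-cancelʳ-≤ ∣ S ∷ʳ false ∣ _ _ (subst₂ _≤_ (∣fromProfile∣ S zw) (∣fromProfile∣ S zu) d)))
    (λ h → subst₂ _≤_ (sym (∣fromProfile∣ S zw)) (sym (∣fromProfile∣ S zu)) (+-monoˡ-≤ ∣ S ∷ʳ false ∣ (toℕ-mono h)))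

fromProfile-≼⇒⊆ : ∀ {m} (S : Subset m) {w u} → Profile S w → Profile S u → fromProfile S w ≼ fromProfile S u → w ⊆ u
fromProfile-≼⇒⊆ []      {_ ∷ []}    {_ ∷ []}    zw        zu        (d , _)  =
  ∷-⊆ (Equivalence.to (∣fromProfile∣-≤⇔head-≤ [] zw zu) d) ⊆-refl
fromProfile-≼⇒⊆ (s ∷ S) {_ ∷ _ ∷ _} {_ ∷ _ ∷ _} (sw , zw) (su , zu) (d , ds) =
  ∷-⊆ (Equivalence.to (∣fromProfile∣-≤⇔head-≤ (s ∷ S) (sw , zw) (su , zu)) d) (fromProfile-≼⇒⊆ S zw zu ds)

⊆⇒fromProfile-≼ : ∀ {m} (S : Subset m) {w u} → Profile S w → Profile S u → w ⊆ u → fromProfile S w ≼ fromProfile S u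
⊆⇒fromProfile-≼ []      {_ ∷ []}    {_ ∷ []}    zw        zu        w⊆u =
  Equivalence.from (∣fromProfile∣-≤⇔head-≤ [] zw zu) (⊆-head w⊆u) , tt
⊆⇒fromProfile-≼ (s ∷ S) {_ ∷ _ ∷ _} {_ ∷ _ ∷ _} (sw , zw) (su , zu) w⊆u =
  Equivalence.from (∣fromProfile∣-≤⇔head-≤ (s ∷ S) (sw , zw) (su , zu)) (⊆-head w⊆u) ,
  ⊆⇒fromProfile-≼ S zw zu (drop-∷-⊆ w⊆u)

≼-interval⇒profile : ∀ {m} (S : Subset m) A → S ∷ʳ false ≼ A → A ≼ S ∷ʳ true →
                     ∃[ w ] Profile S w × fromProfile S w ≡ A
≼-interval⇒profile []      (a ∷ []) _ _ = (a ∷ []) , tt , refl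
≼-interval⇒profile (s ∷ S) (a ∷ A) (d₁ , ds₁) (d₂ , ds₂) with ≼-interval⇒profile S A ds₁ ds₂
... | w₂ ∷ w , zw , refl = extend s a w₂ zw lower upper
  where
  c = ∣ S ∷ʳ false ∣
  ∣A∣ : ∣ a ∷ fromProfile S (w₂ ∷ w) ∣ ≡ toℕ a + (toℕ w₂ + c)
  ∣A∣ = trans (∣∷∣ a (fromProfile S (w₂ ∷ w))) (cong (_+_ (toℕ a)) (∣fromProfile∣ S zw))
  lower : toℕ s + c ≤ toℕ a + (toℕ w₂ + c)
  lower = subst₂ _≤_ (∣∷∣ s (S ∷ʳ false)) ∣A∣ d₁
  upper : toℕ a + (toℕ w₂ + c) ≤ toℕ s + suc c
  upper = subst₂ _≤_ ∣A∣ (trans (∣∷∣ s (S ∷ʳ true)) (cong (_+_ (toℕ s)) (∣∷ʳtrue∣ S))) d₂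
  extend : ∀ s a x → Profile S (x ∷ w) → toℕ s + c ≤ toℕ a + (toℕ x + c) → toℕ a + (toℕ x + c) ≤ toℕ s + suc c →
           ∃[ w′ ] Profile (s ∷ S) w′ × fromProfile (s ∷ S) w′ ≡ a ∷ fromProfile S (x ∷ w)
  extend true  false false zw lo _  = contradiction lo 1+n≰n
  extend true  false true  zw _  _  = (false ∷ true ∷ w)  , (f≤t , zw) , refl
  extend true  true  false zw _  _  = (false ∷ false ∷ w) , (b≤b , zw) , refl
  extend true  true  true  zw _  _  = (true ∷ true ∷ w)   , (b≤b , zw) , refl
  extend false false false zw _  _  = (false ∷ false ∷ w) , (b≤b , zw) , refl
  extend false false true  zw _  _  = (true ∷ true ∷ w)   , (b≤b , zw) , refl
  extend false true  false zw _  _  = (true ∷ false ∷ w)  , (f≤t , zw) , refl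
  extend false true  true  zw _  up = contradiction up (1+n≰n ∘ s≤s⁻¹)

module _ {m} (S : Subset m) where

  profile⇒inInterval : ∀ {w} → Profile S w → InInterval (S ∷ʳ false) (S ∷ʳ true) (fromProfile S w)
  profile⇒inInterval zw = Equivalence.from (≤G⇔≼ _ _) (S′≼fromProfile S zw) ,
                          Equivalence.from (≤G⇔≼ _ _) (fromProfile≼T′ S zw)

  inInterval⇒profile : ∀ {A} → InInterval (S ∷ʳ false) (S ∷ʳ true) A → ∃[ w ] Profile S w × fromProfile S w ≡ A
  inInterval⇒profile {A} (S′≤A , A≤T′) =
    ≼-interval⇒profile S A (Equivalence.to (≤G⇔≼ _ _) S′≤A) (Equivalence.to (≤G⇔≼ _ _) A≤T′)

  fromProfile-≤G⇔⊆ : ∀ {w u} → Profile S w → Profile S u → fromProfile S w ≤G fromProfile S u ⇔ w ⊆ u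
  fromProfile-≤G⇔⊆ zw zu = mk⇔ (fromProfile-≼⇒⊆ S zw zu ∘ Equivalence.to (≤G⇔≼ _ _))
                               (Equivalence.from (≤G⇔≼ _ _) ∘ ⊆⇒fromProfile-≼ S zw zu)

  fromProfile-injective : ∀ {w u} → Profile S w → Profile S u → fromProfile S w ≡ fromProfile S u → w ≡ u
  fromProfile-injective zw zu e = ⊆-antisym (fromProfile-≼⇒⊆ S zw zu (subst (_ ≼_) e (≼-refl _)))
                                            (fromProfile-≼⇒⊆ S zu zw (subst (_ ≼_) (sym e) (≼-refl _)))

⊥-profile : ∀ {m} (S : Subset m) → Profile S ⊥
⊥-profile S = Zigzag-replicate Bool.≤-refl S false

⊤-profile : ∀ {m} (S : Subset m) → Profile S ⊤
⊤-profile S = Zigzag-replicate Bool.≤-refl S true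

∩-profile : ∀ {m} (S : Subset m) {w u} → Profile S w → Profile S u → Profile S (w ∩ u)
∩-profile = Zigzag-zipWith ∧-mono-≤

⋂-profile : ∀ {m} (S : Subset m) {ps} → All (Profile S) ps → Profile S (⋂ ps)
⋂-profile S []           = ⊤-profile S
⋂-profile S (zp ∷ zps)   = ∩-profile S zp (⋂-profile S zps)

cover : ∀ {m} (S : Subset m) {w u} → Profile S w → Profile S u → w ⊆ u → w ≢ u →
        ∃[ k ] k ∉ₛ w × k ∈ₛ u × Profile S (insert k w)
cover []      {false ∷ []} {false ∷ []} _ _ _   w≢u = contradiction refl w≢u
cover []      {false ∷ []} {true ∷ []}  _ _ _   _   = zero , (λ ()) , Vec.here , tt
cover []      {true ∷ []}  {false ∷ []} _ _ w⊆u _   = contradiction (⊆-head w⊆u) λ ()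
cover []      {true ∷ []}  {true ∷ []}  _ _ _   w≢u = contradiction refl w≢u
cover (s ∷ S) {a ∷ x ∷ w} {b ∷ y ∷ u} (sw , zw) (su , zu) w⊆u w≢u with (x ∷ w) ≟ˢ (y ∷ u)
... | yes refl with ⊆-head w⊆u
...   | f≤t = zero , (λ ()) , Vec.here , (su , zw)
...   | b≤b = contradiction refl w≢u
cover (s ∷ S) {a ∷ x ∷ w} {b ∷ y ∷ u} (sw , zw) (su , zu) w⊆u w≢u | no w≢u′
  with cover S zw zu (drop-∷-⊆ w⊆u) w≢u′
... | suc j , j∉ , j∈ , zj = suc (suc j) , j∉ ∘ drop-there , Vec.there j∈ , (sw , zj)
... | zero  , x∉ , Vec.here , zj with x | s | a
...   | true  | _     | _     = contradiction Vec.here x∉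
...   | false | true  | a     = suc zero , x∉ ∘ drop-there , Vec.there Vec.here , (Bool.≤-maximum a , zj)
...   | false | false | true  = suc zero , x∉ ∘ drop-there , Vec.there Vec.here , (b≤b , zj)
...   | false | false | false with su
...     | b≤b = zero , (λ ()) , Vec.here , (f≤t , zw)

-- Maximal chains

Saturation : ∀ {m} → Subset m → Subset (suc m) → List (Fin (suc m)) → Set
Saturation S w []       = w ≡ ⊤
Saturation S w (k ∷ ks) = k ∉ₛ w × Profile S (insert k w) × Saturation S (insert k w) ks

saturation? : ∀ {m} (S : Subset m) w ks → Dec (Saturation S w ks)
saturation? S w []       = w ≟ˢ ⊤
saturation? S w (k ∷ ks) = ¬? (k ∈? w) ×-dec (zigzag? Bool._≤?_ S (insert k w) ×-dec saturation? S (insert k w) ks)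

prefixes      : ∀ {n} → Subset n → List (Fin n) → List (Subset n)
laterPrefixes : ∀ {n} → Subset n → List (Fin n) → List (Subset n)
prefixes w ks = w ∷ laterPrefixes w ks
laterPrefixes w []       = []
laterPrefixes w (k ∷ ks) = prefixes (insert k w) ks

prefixes-⊇ : ∀ {n} (w : Subset n) ks → All (w ⊆_) (prefixes w ks)
prefixes-⊇ w []       = ⊆-refl ∷ []
prefixes-⊇ w (k ∷ ks) = ⊆-refl ∷ All.map (⊆-trans insert-⊇) (prefixes-⊇ (insert k w) ks)

module _ {m} {S : Subset m} where

  saturation-length : ∀ {w} ks → Saturation S w ks → length ks + ∣ w ∣ ≡ suc m
  saturation-length []       refl             = ∣⊤∣≡n (suc m)
  saturation-length {w} (k ∷ ks) (k∉ , _ , sat) =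
    trans (sym (+-suc (length ks) ∣ w ∣)) (trans (cong (_+_ (length ks)) (sym (∣insert∣ k w k∉))) (saturation-length ks sat))

  saturation-fresh : ∀ {w} ks → Saturation S w ks → All (_∉ₛ w) ks
  saturation-fresh []       _              = []
  saturation-fresh (k ∷ ks) (k∉ , _ , sat) = k∉ ∷ All.map (_∘ insert-⊇) (saturation-fresh ks sat)

  saturation-unique : ∀ {w} ks → Saturation S w ks → Unique ks
  saturation-unique []            _              = []
  saturation-unique {w} (k ∷ ks) (_ , _ , sat) =
    All.map (λ i∉ k≡i → i∉ (subst (_∈ₛ insert k w) k≡i (∈-insert k w))) (saturation-fresh ks sat) ∷ saturation-unique ks sat

  saturation-complete : ∀ {w} ks → Saturation S w ks → ∀ {i} → i ∉ₛ w → i ∈ ks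
  saturation-complete []       refl           i∉ = contradiction ∈⊤ i∉
  saturation-complete (k ∷ ks) (_ , _ , sat) {i} i∉ with i ≟ᶠ k
  ... | yes i≡k = here i≡k
  ... | no i≢k  = there (saturation-complete ks sat λ i∈ → i∉ (∈-insert⁻ i∈ i≢k))

  prefixes-profile : ∀ {w} ks → Profile S w → Saturation S w ks → All (Profile S) (prefixes w ks)
  prefixes-profile []       zw _              = zw ∷ []
  prefixes-profile (k ∷ ks) zw (_ , zk , sat) = zw ∷ prefixes-profile ks zk sat

  prefixes-injective : ∀ {w} ks ks′ → Saturation S w ks → Saturation S w ks′ → prefixes w ks ≡ prefixes w ks′ → ks ≡ ks′
  prefixes-injective []       []         _              _ _ = refl
  prefixes-injective []       (_ ∷ _)    _              _ e = contradiction (∷-injectiveʳ e) λ ()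
  prefixes-injective (_ ∷ _)  []         _              _ e = contradiction (∷-injectiveʳ e) λ ()
  prefixes-injective {w} (k ∷ ks) (k′ ∷ ks′) (k∉ , _ , sat) (_ , _ , sat′) e with ∷-injectiveʳ e | k ≟ᶠ k′
  ... | e′ | yes refl = cong (k ∷_) (prefixes-injective ks ks′ sat sat′ e′)
  ... | e′ | no k≢k′  = contradiction (∈-insert⁻ (subst (k ∈ₛ_) (∷-injectiveˡ e′) (∈-insert k w)) k≢k′) k∉

  prefixes-⊂ : ∀ {w} ks → Saturation S w ks → AllPairs _⊂_ (prefixes w ks)
  prefixes-⊂ []       _              = [] ∷ []
  prefixes-⊂ (k ∷ ks) (k∉ , _ , sat) = All.map (⊂-⊆-trans (insert-⊂ k∉)) (prefixes-⊇ _ ks) ∷ prefixes-⊂ ks sat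

  comparable⇒prefix : ∀ {w x} ks → Saturation S w ks → w ⊆ x → All (Comparable x) (prefixes w ks) → x ∈ prefixes w ks
  comparable⇒prefix []            refl           w⊆x _ = here (⊆-antisym ⊆⊤ w⊆x)
  comparable⇒prefix {w} {x} (k ∷ ks) (k∉ , _ , sat) w⊆x (_ ∷ c ∷ cs) with x ≟ˢ w
  ... | yes x≡w = here x≡w
  ... | no x≢w with c
  ...   | inj₂ w′⊆x = there (comparable⇒prefix ks sat w′⊆x (c ∷ cs))
  ...   | inj₁ x⊆w′ = there (here (⊆-∣∣-≡ x⊆w′ ∣x∣≡∣w′∣))
    where
    ∣x∣≡∣w′∣ : ∣ x ∣ ≡ ∣ insert k w ∣
    ∣x∣≡∣w′∣ = ≤-antisym (p⊆q⇒∣p∣≤∣q∣ x⊆w′) (subst (_≤ ∣ x ∣) (sym (∣insert∣ k w k∉)) (⊆∧≢⇒∣∣< w⊆x (x≢w ∘ sym)))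

chain-⊈⇒≢⋂ : ∀ {n} {w : Subset n} U → AllPairs Comparable U → All (λ t → ¬ t ⊆ w) U → w ≢ ⊤ → w ≢ ⋂ U
chain-⊈⇒≢⋂ []      _  _    w≢⊤ = w≢⊤
chain-⊈⇒≢⋂ (t ∷ U) cs t⊈w  _   w≡⋂ = All.lookup t⊈w (⋂-chain-∈ t U cs) (⊆-reflexive (sym w≡⋂))

module _ {m} (S : Subset m) {ts : List (Subset (suc m))} (zts : All (Profile S) ts) (cts : AllPairs Comparable ts) where

  -- Climb towards the meet of the chain members not yet below w.
  step-along-chain : ∀ {w} → Profile S w → All (Comparable w) ts → w ≢ ⊤ →
                     ∃[ k ] k ∉ₛ w × Profile S (insert k w) × All (Comparable (insert k w)) ts
  step-along-chain {w} zw cw w≢⊤ = climb (cover S zw (⋂-profile S (All.filter⁺ above? zts)) w⊆⋂U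
                                              (chain-⊈⇒≢⋂ U (AllPairs.filter⁺ above? cts) (All.all-filter above? ts) w≢⊤))
    where
    above? = λ t → ¬? (t ⊆? w)
    U = filter above? ts
    w⊆⋂U : w ⊆ ⋂ U
    w⊆⋂U = ⊆-⋂ (All.tabulate λ t∈U → let t∈ts , t⊈w = ∈-filter⁻ above? t∈U in
                   comparable-⊈ (All.lookup cw t∈ts) t⊈w)
    climb : ∃[ k ] k ∉ₛ w × k ∈ₛ ⋂ U × Profile S (insert k w) →
            ∃[ k ] k ∉ₛ w × Profile S (insert k w) × All (Comparable (insert k w)) ts
    climb (k , k∉ , k∈⋂U , zk) = k , k∉ , zk , All.tabulate comparable
      where
      comparable : ∀ {t} → t ∈ ts → Comparable (insert k w) t
      comparable {t} t∈ts with t ⊆? w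
      ... | yes t⊆w = inj₂ (⊆-trans t⊆w insert-⊇)
      ... | no t⊈w  = inj₁ (⊆-trans (insert-⊆ w⊆⋂U k∈⋂U) (⋂-⊆ (∈-filter⁺ above? t∈ts t⊈w)))

  extend-along-chain : ∀ fuel {w} → ∣ w ∣ + fuel ≡ suc m → Profile S w → All (Comparable w) ts →
                       ∃[ ks ] Saturation S w ks × All (λ p → All (Comparable p) ts) (prefixes w ks)
  extend-along-chain fuel {w} e zw cw with w ≟ˢ ⊤
  ... | yes refl = [] , refl , cw ∷ []
  extend-along-chain zero       e zw cw | no w≢⊤ = contradiction (∣p∣≡n⇒p≡⊤ (trans (sym (+-identityʳ _)) e)) w≢⊤
  extend-along-chain (suc fuel) {w} e zw cw | no w≢⊤ with step-along-chain zw cw w≢⊤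
  ... | k , k∉ , zk , ck with extend-along-chain fuel (trans (cong (_+ fuel) (∣insert∣ k w k∉)) (trans (sym (+-suc _ fuel)) e)) zk ck
  ...   | ks , sat , cks = k ∷ ks , (k∉ , zk , sat) , cw ∷ cks

  chain⇒saturation : ∃[ ks ] Saturation S ⊥ ks × All (λ p → All (Comparable p) ts) (prefixes ⊥ ks)
  chain⇒saturation = extend-along-chain (suc m) (cong (_+ suc m) (∣⊥∣≡0 (suc m))) (⊥-profile S)
                                        (All.universal ⊥-comparable ts)

module MaximalChains {m} (S : Subset m) where

  S′ T′ : Subset (suc m)
  S′ = S ∷ʳ false
  T′ = S ∷ʳ true

  ≤G⇒comparable : ∀ {w u} → Profile S w → Profile S u →
                  fromProfile S w ≤G fromProfile S u ⊎ fromProfile S u ≤G fromProfile S w → Comparable w u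
  ≤G⇒comparable zw zu = Sum.map (Equivalence.to (fromProfile-≤G⇔⊆ S zw zu)) (Equivalence.to (fromProfile-≤G⇔⊆ S zu zw))

  lift-profiles : ∀ {C} → All (InInterval S′ T′) C → ∃[ ws ] All (Profile S) ws × map (fromProfile S) ws ≡ C
  lift-profiles []         = [] , [] , refl
  lift-profiles {A ∷ C} (A∈ ∷ C∈) with inInterval⇒profile S {A} A∈ | lift-profiles {C} C∈
  ... | w , zw , refl | ws , zws , refl = w ∷ ws , zw ∷ zws , refl

  flag : List (Fin (suc m)) → List (Subset (suc m))
  flag ks = map (fromProfile S) (prefixes ⊥ ks)

  module _ {ks} (sat : Saturation S ⊥ ks) where

    private
      zps = prefixes-profile ks (⊥-profile S) sat

    flag-chain : IsChain S′ T′ (flag ks)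
    flag-chain = All.map⁺ (All.map (profile⇒inInterval S) zps)
               , AllPairs.map⁺ (AllPairs-mapᴾ strict zps (prefixes-⊂ ks sat))
      where
      strict : ∀ {w u} → Profile S w → Profile S u → w ⊂ u → fromProfile S w <G fromProfile S u
      strict zw zu w⊂u = Equivalence.from (fromProfile-≤G⇔⊆ S zw zu) (proj₁ w⊂u)
                       , λ e → ⊂-irref (fromProfile-injective S zw zu e) w⊂u

    flag-maximal : IsMaximalChain S′ T′ (flag ks)
    flag-maximal = flag-chain , λ C′ (C′-int , C′<) flag⊆C′ {A} A∈C′ → maximal C′-int C′< flag⊆C′ A∈C′
      where
      maximal : ∀ {C′} → All (InInterval S′ T′) C′ → AllPairs _<G_ C′ → (∀ {A} → A ∈ flag ks → A ∈ C′) →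
                ∀ {A} → A ∈ C′ → A ∈ flag ks
      maximal C′-int C′< flag⊆C′ {A} A∈C′ with inInterval⇒profile S {A} (All.lookup C′-int A∈C′)
      ... | w , zw , refl = ∈-map⁺ (fromProfile S)
        (comparable⇒prefix ks sat ⊥⊆ (All.tabulate λ {p} p∈ →
           ≤G⇒comparable zw (All.lookup zps p∈) (chain-≤G-total C′< A∈C′ (flag⊆C′ (∈-map⁺ (fromProfile S) p∈)))))

  maximal⇒flag : ∀ {C} → IsMaximalChain S′ T′ C → ∃[ ks ] Saturation S ⊥ ks × C ≡ flag ks
  maximal⇒flag {C} ((C-int , C<) , maximal) with lift-profiles C-int
  ... | ws , zws , refl with chain⇒saturation S zws (AllPairs-mapᴾ (λ zw zu w<u → ≤G⇒comparable zw zu (inj₁ (proj₁ w<u)))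
                                                                     zws (AllPairs.map⁻ C<))
  ... | ks , sat , cks = ks , sat , AllPairs-≡ <G-irrefl <G-asym C< (proj₂ (flag-chain sat)) C⊆flag flag⊆C
    where
    C⊆flag : ∀ {A} → A ∈ map (fromProfile S) ws → A ∈ flag ks
    C⊆flag A∈ with ∈-map⁻ (fromProfile S) A∈
    ... | w , w∈ , refl = ∈-map⁺ (fromProfile S)
      (comparable⇒prefix ks sat ⊥⊆ (All.tabulate λ p∈ → comparable-sym (All.lookup (All.lookup cks p∈) w∈)))
    flag⊆C : ∀ {A} → A ∈ flag ks → A ∈ map (fromProfile S) ws
    flag⊆C = maximal (flag ks) (flag-chain sat) C⊆flag

  flag-injective : ∀ {ks ks′} → Saturation S ⊥ ks → Saturation S ⊥ ks′ → flag ks ≡ flag ks′ → ks ≡ ks′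
  flag-injective sat sat′ e = prefixes-injective _ _ sat sat′
    (map-injectiveᴾ (fromProfile-injective S) (prefixes-profile _ (⊥-profile S) sat) (prefixes-profile _ (⊥-profile S) sat′) e)

  saturations : List (List (Fin (suc m)))
  saturations = filter (saturation? S ⊥) (listsOfLength (suc m) (allFin (suc m)))

  saturations-unique : Unique saturations
  saturations-unique = Unique.filter⁺ (saturation? S ⊥) (listsOfLength-unique (suc m) (Unique.allFin⁺ (suc m)))

  saturations-sound : All (Saturation S ⊥) saturations
  saturations-sound = All.all-filter (saturation? S ⊥) (listsOfLength (suc m) (allFin (suc m)))

  saturation-length-⊥ : ∀ {ks} → Saturation S ⊥ ks → length ks ≡ suc m
  saturation-length-⊥ {ks} sat = trans (sym (+-identityʳ (length ks)))
    (trans (cong (_+_ (length ks)) (sym (∣⊥∣≡0 (suc m)))) (saturation-length ks sat))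

  saturations-complete : ∀ {ks} → Saturation S ⊥ ks → ks ∈ saturations
  saturations-complete {ks} sat = ∈-filter⁺ (saturation? S ⊥)
    (subst (λ l → ks ∈ listsOfLength l (allFin (suc m))) (saturation-length-⊥ sat)
           (listsOfLength-complete ks (All.universal ∈-allFin ks)))
    sat

  maximalChains : List (List (Subset (suc m)))
  maximalChains = map flag saturations

  maximalChains-enumeration : IsMaxChainEnumeration S′ T′ maximalChains
  maximalChains-enumeration = Unique-map⁺ᴾ flag-injective saturations-sound saturations-unique , λ C → mk⇔ (sound C) (complete C)
    where
    sound : ∀ C → C ∈ maximalChains → IsMaximalChain S′ T′ C
    sound C C∈ with ∈-map⁻ flag C∈
    ... | ks , ks∈ , refl = flag-maximal (All.lookup saturations-sound ks∈)
    complete : ∀ C → IsMaximalChain S′ T′ C → C ∈ maximalChains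
    complete C max with maximal⇒flag max
    ... | ks , sat , refl = ∈-map⁺ flag (saturations-complete sat)

-- Height functions

Heights : ∀ {m} → Subset m → Vec ℕ (suc m) → Set
Heights = Zigzag _≤_

level : ∀ {k} → ℕ → Vec ℕ k → Subset k
level j = Vec.map (j ≤ᵇ_)

∈-level : ∀ {k} {j} {z : Vec ℕ k} {i} → i ∈ₛ level j z ⇔ j ≤ lookup z i
∈-level {j = j} {z} {i} = mk⇔
  (λ i∈ → ≤ᵇ⇒≤ j (lookup z i) (Equivalence.from Bool.T-≡ (trans (sym (lookup-map i (j ≤ᵇ_) z)) ([]=⇒lookup i∈))))
  (λ j≤ → lookup⇒[]= i (level j z) (trans (lookup-map i (j ≤ᵇ_) z) (Equivalence.to Bool.T-≡ (≤⇒≤ᵇ j≤))))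

level-antitone : ∀ {k} (z : Vec ℕ k) {i j} → i ≤ j → level j z ⊆ level i z
level-antitone z i≤j x∈ = Equivalence.from ∈-level (≤-trans i≤j (Equivalence.to ∈-level x∈))

level-profile : ∀ {m} (S : Subset m) {z} j → Heights S z → Profile S (level j z)
level-profile S j = Zigzag-map (≤ᵇ-mono j) S

levels⇒heights : ∀ {m} (S : Subset m) {z} → (∀ j → Profile S (level (suc j) z)) → Heights S z
levels⇒heights S = Zigzag-reflect ≤ᵇ-reflect S

level-replicate-0 : ∀ k j → level (suc j) (replicate k 0) ≡ ⊥
level-replicate-0 k j = map-replicate (suc j ≤ᵇ_) 0 k

Σ< : ℕ → (ℕ → ℕ) → ℕ
Σ< zero    f = 0
Σ< (suc t) f = f 0 + Σ< t (f ∘ suc)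

Σ<-cong : ∀ t {f g} → (∀ j → f j ≡ g j) → Σ< t f ≡ Σ< t g
Σ<-cong zero    f≗g = refl
Σ<-cong (suc t) f≗g = cong₂ _+_ (f≗g 0) (Σ<-cong t (f≗g ∘ suc))

Σ<-+ : ∀ t f g → Σ< t (λ j → f j + g j) ≡ Σ< t f + Σ< t g
Σ<-+ zero    f g = refl
Σ<-+ (suc t) f g rewrite Σ<-+ t (f ∘ suc) (g ∘ suc) = interchange (f 0) (g 0) (Σ< t (f ∘ suc)) (Σ< t (g ∘ suc))
  where
  open ℕ-Solver
  interchange : ∀ a b c d → a + b + (c + d) ≡ a + c + (b + d)
  interchange = solve 4 (λ a b c d → a :+ b :+ (c :+ d) := a :+ c :+ (b :+ d)) refl

Σ<-const : ∀ t c → Σ< t (λ _ → c) ≡ t * c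
Σ<-const zero    c = refl
Σ<-const (suc t) c = cong (_+_ c) (Σ<-const t c)

Σ<-level : ∀ t a → a ≤ t → Σ< t (λ j → toℕ (suc j ≤ᵇ a)) ≡ a
Σ<-level zero    zero    _       = refl
Σ<-level (suc t) zero    _       = trans (Σ<-const t 0) (*-zeroʳ t)
Σ<-level (suc t) (suc a) (s≤s a≤t) = cong suc (Σ<-level t a a≤t)

assign : ∀ {n} → List (Fin n) → List ℕ → Vec ℕ n
assign []       _        = replicate _ 0
assign (k ∷ ks) []       = replicate _ 0
assign (k ∷ ks) (v ∷ vs) = assign ks vs [ k ]≔ v

lookup-assign-map : ∀ {n} (z : Vec ℕ n) ks {i} → i ∈ ks → lookup (assign ks (map (lookup z) ks)) i ≡ lookup z i
lookup-assign-map z (k ∷ ks) {i} i∈ with k ≟ᶠ i | i∈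
... | yes refl | _          = lookup∘update k (assign ks (map (lookup z) ks)) (lookup z k)
... | no k≢i   | here i≡k   = contradiction (sym i≡k) k≢i
... | no k≢i   | there i∈ks = trans (lookup∘update′ (k≢i ∘ sym) (assign ks (map (lookup z) ks)) (lookup z k))
                                    (lookup-assign-map z ks i∈ks)

map-lookup-assign : ∀ {n} (ks : List (Fin n)) vs → Unique ks → length vs ≡ length ks → map (lookup (assign ks vs)) ks ≡ vs
map-lookup-assign []       []       _          _ = refl
map-lookup-assign (k ∷ ks) (v ∷ vs) (k∉ ∷ uks) e =
  cong₂ _∷_ (lookup∘update k (assign ks vs) v) (trans (map-lookup-update ks k∉) (map-lookup-assign ks vs uks (suc-injective e)))
  where
  map-lookup-update : ∀ js → All (k ≢_) js → map (lookup (assign ks vs [ k ]≔ v)) js ≡ map (lookup (assign ks vs)) js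
  map-lookup-update []       []          = refl
  map-lookup-update (j ∷ js) (k≢j ∷ k∉) = cong₂ _∷_ (lookup∘update′ (k≢j ∘ sym) (assign ks vs) v) (map-lookup-update js k∉)

assign-≤ : ∀ {n} (ks : List (Fin n)) vs {t} → All (_≤ t) vs → ∀ i → lookup (assign ks vs) i ≤ t
assign-≤ []       vs       _          i = subst (_≤ _) (sym (lookup-replicate i 0)) z≤n
assign-≤ (k ∷ ks) []       _          i = subst (_≤ _) (sym (lookup-replicate i 0)) z≤n
assign-≤ (k ∷ ks) (v ∷ vs) (v≤ ∷ vs≤) i with k ≟ᶠ i
... | yes refl = subst (_≤ _) (sym (lookup∘update k (assign ks vs) v)) v≤
... | no k≢i   = subst (_≤ _) (sym (lookup∘update′ (k≢i ∘ sym) (assign ks vs) v)) (assign-≤ ks vs vs≤ i)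

level-assign-⊥ : ∀ {n} (ks : List (Fin n)) vs j → All (_≤ j) vs → level (suc j) (assign ks vs) ≡ ⊥
level-assign-⊥ []       vs       j _          = level-replicate-0 _ j
level-assign-⊥ (k ∷ ks) []       j _          = level-replicate-0 _ j
level-assign-⊥ (k ∷ ks) (v ∷ vs) j (v≤ ∷ vs≤) = begin
  level (suc j) (assign ks vs [ k ]≔ v)              ≡⟨ map-[]≔ (suc j ≤ᵇ_) (assign ks vs) k ⟩
  level (suc j) (assign ks vs) [ k ]≔ (suc j ≤ᵇ v)    ≡⟨ cong₂ (_[ k ]≔_) (level-assign-⊥ ks vs j vs≤) (≤ᵇ-false (s≤s v≤)) ⟩
  ⊥ [ k ]≔ false                                      ≡⟨ cong (⊥ [ k ]≔_) (sym (lookup-replicate k false)) ⟩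
  ⊥ [ k ]≔ lookup ⊥ k                                 ≡⟨ []≔-lookup ⊥ k ⟩
  ⊥                                                   ∎
  where open ≡-Reasoning

level-assign-∈-prefixes : ∀ {n} {w : Subset n} ks vs j → WeaklyDecreasing vs → length vs ≡ length ks →
                          level (suc j) (assign ks vs) ∪ w ∈ prefixes w ks
level-assign-∈-prefixes {w = w} []       vs       j _          _ = here (trans (cong (_∪ w) (level-replicate-0 _ j)) (∪-identityˡ w))
level-assign-∈-prefixes {w = w} (k ∷ ks) (v ∷ vs) j (v≥ ∷ dvs) e with suc j ℕ.≤? v
... | yes j<v = there (subst (_∈ prefixes (insert k w) ks) (sym step) (level-assign-∈-prefixes ks vs j dvs (suc-injective e)))
  where
  open ≡-Reasoning
  step : level (suc j) (assign ks vs [ k ]≔ v) ∪ w ≡ level (suc j) (assign ks vs) ∪ insert k w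
  step = begin
    level (suc j) (assign ks vs [ k ]≔ v) ∪ w           ≡⟨ cong (_∪ w) (map-[]≔ (suc j ≤ᵇ_) (assign ks vs) k) ⟩
    (level (suc j) (assign ks vs) [ k ]≔ (suc j ≤ᵇ v)) ∪ w ≡⟨ cong (λ b → (level (suc j) (assign ks vs) [ k ]≔ b) ∪ w) (≤ᵇ-true j<v) ⟩
    insert k (level (suc j) (assign ks vs)) ∪ w          ≡⟨ insert-∪ k _ w ⟩
    level (suc j) (assign ks vs) ∪ insert k w            ∎
... | no j≮v = here (trans (cong (_∪ w) (level-assign-⊥ (k ∷ ks) (v ∷ vs) j (v≤j ∷ All.map (λ u≤v → ≤-trans u≤v v≤j) v≥)))
                           (∪-identityˡ w))
  where
  v≤j : v ≤ j
  v≤j = ℕ.s≤s⁻¹ (≰⇒> j≮v)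

weaklyDecreasing : ℕ → ℕ → List (List ℕ)
weaklyDecreasing zero    b       = [ [] ]
weaklyDecreasing (suc n) zero    = []
weaklyDecreasing (suc n) (suc b) = weaklyDecreasing (suc n) b ++ map (b ∷_) (weaklyDecreasing n (suc b))

strictlyDecreasing : ℕ → ℕ → List (List ℕ)
strictlyDecreasing zero    b       = [ [] ]
strictlyDecreasing (suc n) zero    = []
strictlyDecreasing (suc n) (suc b) = strictlyDecreasing (suc n) b ++ map (b ∷_) (strictlyDecreasing n b)

weaklyDecreasing-complete : ∀ vs {b} → All (_< b) vs → WeaklyDecreasing vs → vs ∈ weaklyDecreasing (length vs) b
weaklyDecreasing-complete []       _ _ = here refl
weaklyDecreasing-complete (v ∷ vs) = below-b
  where
  below-b : ∀ {b} → All (_< b) (v ∷ vs) → WeaklyDecreasing (v ∷ vs) → v ∷ vs ∈ weaklyDecreasing (suc (length vs)) b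
  below-b {suc b} (v<b ∷ vs<) (v≥ ∷ dvs) with v ≟ b
  ... | yes refl = ∈-++⁺ʳ (weaklyDecreasing (suc (length vs)) v)
                     (∈-map⁺ (v ∷_) (weaklyDecreasing-complete vs (All.map s≤s v≥) dvs))
  ... | no v≢b   = ∈-++⁺ˡ (below-b (v<b′ ∷ All.map (λ u≤v → ≤-<-trans u≤v v<b′) v≥) (v≥ ∷ dvs))
    where
    v<b′ : v < b
    v<b′ = ≤∧≢⇒< (s≤s⁻¹ v<b) v≢b

strictlyDecreasing-sound : ∀ n b {vs} → vs ∈ strictlyDecreasing n b → length vs ≡ n × All (_< b) vs × StrictlyDecreasing vs
strictlyDecreasing-sound zero    b       (here refl) = refl , [] , []
strictlyDecreasing-sound (suc n) (suc b) vs∈ with ∈-++⁻ (strictlyDecreasing (suc n) b) vs∈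
... | inj₁ vs∈′ = let l , vs<b , dvs = strictlyDecreasing-sound (suc n) b vs∈′ in l , All.map m≤n⇒m≤1+n vs<b , dvs
... | inj₂ vs∈′ with ∈-map⁻ (b ∷_) vs∈′
...   | us , us∈ , refl = let l , us<b , dus = strictlyDecreasing-sound n b us∈
                          in cong suc l , ≤-refl ∷ All.map m≤n⇒m≤1+n us<b , us<b ∷ dus

strictlyDecreasing-unique : ∀ n b → Unique (strictlyDecreasing n b)
strictlyDecreasing-unique zero    b       = [] ∷ []
strictlyDecreasing-unique (suc n) zero    = []
strictlyDecreasing-unique (suc n) (suc b) = Unique.++⁺ (strictlyDecreasing-unique (suc n) b)
  (Unique.map⁺ ∷-injectiveʳ (strictlyDecreasing-unique n b)) disjoint
  where
  disjoint : ∀ {vs} → ¬ (vs ∈ strictlyDecreasing (suc n) b × vs ∈ map (b ∷_) (strictlyDecreasing n b))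
  disjoint (vs∈ , vs∈′) with ∈-map⁻ (b ∷_) vs∈′
  ... | _ , _ , refl with strictlyDecreasing-sound (suc n) b vs∈
  ...   | _ , b<b ∷ _ , _ = <-irrefl refl b<b

^-mean-value : ∀ x d k → (x + d) ^ suc k ≤ x ^ suc k + suc k * d * (x + d) ^ k
^-mean-value x d zero = ≤-reflexive (solve 2 (λ x d → (x :+ d) :* con 1 := x :* con 1 :+ con 1 :* d :* con 1) refl x d)
  where open ℕ-Solver
^-mean-value x d (suc k) = begin
  (x + d) * ((x + d) * R)
    ≤⟨ *-monoʳ-≤ (x + d) (^-mean-value x d k) ⟩
  (x + d) * (x * Q + suc k * d * R)
    ≡⟨ solve 5 (λ x d Q R j → (x :+ d) :* (x :* Q :+ j :* d :* R) := x :* (x :* Q) :+ d :* (x :* Q) :+ j :* d :* ((x :+ d) :* R)) refl x d Q R (suc k) ⟩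
  x * (x * Q) + d * (x * Q) + suc k * d * ((x + d) * R)
    ≤⟨ +-monoˡ-≤ (suc k * d * ((x + d) * R)) (+-monoʳ-≤ (x * (x * Q)) (*-monoʳ-≤ d (^-monoˡ-≤ (suc k) (m≤m+n x d)))) ⟩
  x * (x * Q) + d * ((x + d) * R) + suc k * d * ((x + d) * R)
    ≡⟨ solve 5 (λ x d Q P j → x :* (x :* Q) :+ d :* P :+ j :* d :* P := x :* (x :* Q) :+ (con 1 :+ j) :* d :* P) refl x d Q ((x + d) * R) (suc k) ⟩
  x * (x * Q) + suc (suc k) * d * ((x + d) * R) ∎
  where
  open ≤-Reasoning
  open ℕ-Solver
  R = (x + d) ^ k
  Q = x ^ k

^-binomial-lower : ∀ a k → a ^ suc k + suc k * a ^ k ≤ suc a ^ suc k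
^-binomial-lower a zero = ≤-reflexive (solve 1 (λ a → a :* con 1 :+ con 1 :* con 1 := (con 1 :+ a) :* con 1) refl a)
  where open ℕ-Solver
^-binomial-lower a (suc k) = begin
  a * (a * A) + suc (suc k) * (a * A)
    ≤⟨ ≤-reflexive (solve 3 (λ a A j → a :* (a :* A) :+ (con 1 :+ j) :* (a :* A) := (a :* (a :* A) :+ j :* (a :* A)) :+ a :* A) refl a A (suc k)) ⟩
  (a * (a * A) + suc k * (a * A)) + a * A
    ≤⟨ +-monoʳ-≤ (a * (a * A) + suc k * (a * A)) (m≤m+n (a * A) (suc k * A)) ⟩
  (a * (a * A) + suc k * (a * A)) + (a * A + suc k * A)
    ≡⟨ solve 3 (λ a A j → (a :* (a :* A) :+ j :* (a :* A)) :+ (a :* A :+ j :* A) := (con 1 :+ a) :* (a :* A :+ j :* A)) refl a A (suc k) ⟩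
  suc a * (a * A + suc k * A)
    ≤⟨ *-monoʳ-≤ (suc a) (^-binomial-lower a k) ⟩
  suc a * (suc a ^ suc k) ∎
  where
  open ≤-Reasoning
  open ℕ-Solver
  A = a ^ k

weaklyDecreasing-count : ∀ n t → n ! * length (weaklyDecreasing n (suc t)) ≤ (t + n) ^ n
weaklyDecreasing-count zero t = ≤-refl
weaklyDecreasing-count (suc n) zero = begin
  (suc n * n !) * length (map (0 ∷_) (weaklyDecreasing n 1))
    ≡⟨ cong ((suc n * n !) *_) (length-map (0 ∷_) (weaklyDecreasing n 1)) ⟩
  (suc n * n !) * length (weaklyDecreasing n 1)
    ≡⟨ *-assoc (suc n) (n !) _ ⟩
  suc n * (n ! * length (weaklyDecreasing n 1))
    ≤⟨ *-monoʳ-≤ (suc n) (weaklyDecreasing-count n 0) ⟩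
  suc n * (n ^ n)
    ≤⟨ *-monoʳ-≤ (suc n) (^-monoˡ-≤ n (n≤1+n n)) ⟩
  suc n * (suc n ^ n) ∎
  where open ≤-Reasoning
weaklyDecreasing-count (suc n) (suc t) = begin
  (suc n * n !) * length (weaklyDecreasing (suc n) (suc t) ++ map (suc t ∷_) (weaklyDecreasing n (suc (suc t))))
    ≡⟨ cong ((suc n * n !) *_) (length-++-map (weaklyDecreasing (suc n) (suc t)) (suc t ∷_) (weaklyDecreasing n (suc (suc t)))) ⟩
  (suc n * n !) * (A + B)
    ≡⟨ solve 4 (λ j f A B → (j :* f) :* (A :+ B) := (j :* f) :* A :+ j :* (f :* B)) refl (suc n) (n !) A B ⟩
  (suc n * n !) * A + suc n * (n ! * B)
    ≤⟨ +-mono-≤ (weaklyDecreasing-count (suc n) t) (*-monoʳ-≤ (suc n) (weaklyDecreasing-count n (suc t))) ⟩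
  X ^ suc n + suc n * (suc t + n) ^ n
    ≡⟨ cong (λ y → X ^ suc n + suc n * y ^ n) (sym (+-suc t n)) ⟩
  X ^ suc n + suc n * X ^ n
    ≤⟨ ^-binomial-lower X n ⟩
  suc X ^ suc n ∎
  where
  open ≤-Reasoning
  open ℕ-Solver
  A = length (weaklyDecreasing (suc n) (suc t))
  B = length (weaklyDecreasing n (suc (suc t)))
  X = t + suc n

strictlyDecreasing-count : ∀ n a → a ^ n ≤ n ! * length (strictlyDecreasing n (a + n))
strictlyDecreasing-count zero a = ≤-refl
strictlyDecreasing-count (suc n) zero = z≤n
strictlyDecreasing-count (suc n) (suc a) = begin
  suc a ^ suc n
    ≡⟨ cong (_^ suc n) (+-comm 1 a) ⟩
  (a + 1) ^ suc n
    ≤⟨ ^-mean-value a 1 n ⟩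
  a ^ suc n + suc n * 1 * (a + 1) ^ n
    ≡⟨ cong (λ y → a ^ suc n + y) (trans (cong (_* (a + 1) ^ n) (*-identityʳ (suc n))) (cong (λ y → suc n * y ^ n) (+-comm a 1))) ⟩
  a ^ suc n + suc n * suc a ^ n
    ≤⟨ +-mono-≤ (strictlyDecreasing-count (suc n) a) (*-monoʳ-≤ (suc n) (strictlyDecreasing-count n (suc a))) ⟩
  (suc n * n !) * A + suc n * (n ! * length (strictlyDecreasing n (suc a + n)))
    ≡⟨ cong (λ y → (suc n * n !) * A + suc n * (n ! * length (strictlyDecreasing n y))) (sym (+-suc a n)) ⟩
  (suc n * n !) * A + suc n * (n ! * B)
    ≡⟨ solve 4 (λ j f A B → (j :* f) :* A :+ j :* (f :* B) := (j :* f) :* (A :+ B)) refl (suc n) (n !) A B ⟩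
  (suc n * n !) * (A + B)
    ≡⟨ cong ((suc n * n !) *_) (sym (length-++-map (strictlyDecreasing (suc n) (a + suc n)) (a + suc n ∷_) (strictlyDecreasing n (a + suc n)))) ⟩
  (suc n * n !) * length (strictlyDecreasing (suc n) (a + suc n) ++ map (a + suc n ∷_) (strictlyDecreasing n (a + suc n))) ∎
  where
  open ≤-Reasoning
  open ℕ-Solver
  A = length (strictlyDecreasing (suc n) (a + suc n))
  B = length (strictlyDecreasing n (a + suc n))

Bounded : ∀ {k} → ℕ → Vec ℕ k → Set
Bounded t z = ∀ i → lookup z i ≤ t

vecsBounded : ∀ k → ℕ → List (Vec ℕ k)
vecsBounded zero    t = [ [] ]
vecsBounded (suc k) t = cartesianProductWith _∷_ (upTo (suc t)) (vecsBounded k t)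

vecsBounded-unique : ∀ k t → Unique (vecsBounded k t)
vecsBounded-unique zero    t = [] ∷ []
vecsBounded-unique (suc k) t = Unique.cartesianProductWith⁺ _∷_ Vec.∷-injective (Unique.upTo⁺ (suc t)) (vecsBounded-unique k t)

vecsBounded-complete : ∀ {k} t (z : Vec ℕ k) → Bounded t z → z ∈ vecsBounded k t
vecsBounded-complete t []      _   = here refl
vecsBounded-complete t (x ∷ z) z≤t = ∈-cartesianProductWith⁺ _∷_ (∈-upTo⁺ (s≤s (z≤t zero))) (vecsBounded-complete t z (z≤t ∘ suc))

vecsBounded-sound : ∀ {k} t {z : Vec ℕ k} → z ∈ vecsBounded k t → Bounded t z
vecsBounded-sound {suc k} t z∈ i with ∈-cartesianProductWith⁻ _∷_ (upTo (suc t)) (vecsBounded k t) z∈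
... | x , z , x∈ , z∈′ , refl with i
...   | zero  = s≤s⁻¹ (∈-upTo⁻ x∈)
...   | suc i = vecsBounded-sound t z∈′ i

module Count {m} (S : Subset m) (t : ℕ) where
  open MaximalChains S

  n = suc m

  heights : List (Vec ℕ n)
  heights = filter (zigzag? _≤?_ S) (vecsBounded n t)

  heights-unique : Unique heights
  heights-unique = Unique.filter⁺ (zigzag? _≤?_ S) (vecsBounded-unique n t)

  ∈-heights : ∀ {z} → z ∈ heights → Heights S z × Bounded t z
  ∈-heights z∈ = let z∈′ , hz = ∈-filter⁻ (zigzag? _≤?_ S) z∈ in hz , vecsBounded-sound t z∈′

  heights-∈ : ∀ {z} → Heights S z → Bounded t z → z ∈ heights
  heights-∈ {z} hz z≤t = ∈-filter⁺ (zigzag? _≤?_ S) (vecsBounded-complete t z z≤t) hz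

  levels : Vec ℕ n → List (Subset n)
  levels z = map (λ j → level (suc j) z) (upTo t)

  levels-chain : ∀ z → AllPairs Comparable (levels z)
  levels-chain z = AllPairs.map⁺ (AllPairs.applyUpTo⁺₂ _ t comparable)
    where
    comparable : ∀ i j → Comparable (level (suc i) z) (level (suc j) z)
    comparable i j with ≤-total i j
    ... | inj₁ i≤j = inj₂ (level-antitone z (s≤s i≤j))
    ... | inj₂ j≤i = inj₁ (level-antitone z (s≤s j≤i))

  heights-decrease : ∀ {z} → Bounded t z → ∀ {w} ks → Saturation S w ks →
                     All (λ p → All (Comparable p) (levels z)) (prefixes w ks) → AllPairs (λ a b → lookup z b ≤ lookup z a) ks
  heights-decrease z≤t []       _              _              = []
  heights-decrease {z} z≤t {w} (k ∷ ks) (_ , _ , sat) (_ ∷ cks) = All.tabulate below-k ∷ heights-decrease z≤t ks sat cks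
    where
    below-k : ∀ {k′} → k′ ∈ ks → lookup z k′ ≤ lookup z k
    below-k {k′} k′∈ with lookup z k′ in eq
    ... | zero  = z≤n
    ... | suc j with All.lookup (All.lookup cks (here refl)) (∈-map⁺ (λ j → level (suc j) z) (∈-upTo⁺ (subst (_≤ t) eq (z≤t k′))))
    ...   | inj₁ w′⊆L = Equivalence.to ∈-level (w′⊆L (∈-insert k w))
    ...   | inj₂ L⊆w′ = contradiction (L⊆w′ (Equivalence.from ∈-level (subst (suc j ≤_) (sym eq) ≤-refl)))
                                      (All.lookup (saturation-fresh ks sat) k′∈)

  candidates⁺ : List (List (Fin n) × List ℕ)
  candidates⁺ = cartesianProduct saturations (weaklyDecreasing n (suc t))

  heights-⊆-assignments : ∀ {z} → z ∈ heights → z ∈ map (uncurry assign) candidates⁺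
  heights-⊆-assignments {z} z∈ with ∈-heights z∈
  ... | hz , z≤t with chain⇒saturation S (All.map⁺ (All.universal (λ j → level-profile S (suc j) hz) (upTo t))) (levels-chain z)
  ... | ks , sat , cks = subst (_∈ map (uncurry assign) candidates⁺) assign-values
                           (∈-map⁺ (uncurry assign) (∈-cartesianProduct⁺ (saturations-complete sat) values∈))
    where
    values∈ : map (lookup z) ks ∈ weaklyDecreasing n (suc t)
    values∈ = subst (λ l → map (lookup z) ks ∈ weaklyDecreasing l (suc t)) (trans (length-map (lookup z) ks) (saturation-length-⊥ sat))
      (weaklyDecreasing-complete (map (lookup z) ks) (All.map⁺ (All.universal (s≤s ∘ z≤t) ks))
                                 (AllPairs.map⁺ (heights-decrease z≤t ks sat cks)))
    assign-values : assign ks (map (lookup z) ks) ≡ z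
    assign-values = trans (sym (tabulate∘lookup _)) (trans (tabulate-cong λ i →
      lookup-assign-map z ks (saturation-complete ks sat (∉⊥ {x = i}))) (tabulate∘lookup z))

  upper-bound : length heights ≤ length saturations * length (weaklyDecreasing n (suc t))
  upper-bound = subst (length heights ≤_) (trans (length-map (uncurry assign) candidates⁺) (length-cartesianProductWith _,_ saturations _))
                      (Unique-⊆⇒length-≤ heights-unique heights-⊆-assignments)

  candidates⁻ : List (List (Fin n) × List ℕ)
  candidates⁻ = cartesianProduct saturations (strictlyDecreasing n (suc t))

  Candidate⁻ : List (Fin n) × List ℕ → Set
  Candidate⁻ (ks , vs) = Saturation S ⊥ ks × vs ∈ strictlyDecreasing n (suc t)

  candidates⁻-sound : All Candidate⁻ candidates⁻
  candidates⁻-sound = All.tabulate λ {(ks , vs)} c∈ → let ks∈ , vs∈ = ∈-cartesianProduct⁻ saturations _ c∈ in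
                        All.lookup saturations-sound ks∈ , vs∈

  map-lookup-assign⁻ : ∀ {ks vs} → Candidate⁻ (ks , vs) → map (lookup (assign ks vs)) ks ≡ vs
  map-lookup-assign⁻ {ks} {vs} (sat , vs∈) = map-lookup-assign ks vs (saturation-unique ks sat)
    (trans (proj₁ (strictlyDecreasing-sound n (suc t) vs∈)) (sym (saturation-length-⊥ sat)))

  assign-injective : ∀ {c c′} → Candidate⁻ c → Candidate⁻ c′ → uncurry assign c ≡ uncurry assign c′ → c ≡ c′
  assign-injective {ks , vs} {ks′ , vs′} c@(sat , vs∈) c′@(sat′ , vs′∈) e = cong₂ _,_ ks≡ks′ vs≡vs′
    where
    sorted : ∀ {ks vs} → Candidate⁻ (ks , vs) → AllPairs (λ a b → lookup (assign ks vs) b < lookup (assign ks vs) a) ks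
    sorted {ks} {vs} c@(_ , vs∈) = AllPairs.map⁻ (subst StrictlyDecreasing (sym (map-lookup-assign⁻ c))
                                                        (proj₂ (proj₂ (strictlyDecreasing-sound n (suc t) vs∈))))
    ks≡ks′ : ks ≡ ks′
    ks≡ks′ = AllPairs-≡ (λ {x} → <-irrefl refl) <-asym (sorted c)
                        (subst (λ y → AllPairs (λ a b → lookup y b < lookup y a) ks′) (sym e) (sorted c′))
                        (λ {i} _ → saturation-complete ks′ sat′ (∉⊥ {x = i}))
                        (λ {i} _ → saturation-complete ks sat (∉⊥ {x = i}))
    vs≡vs′ : vs ≡ vs′
    vs≡vs′ = trans (sym (map-lookup-assign⁻ c)) (trans (cong₂ (λ y js → map (lookup y) js) e ks≡ks′) (map-lookup-assign⁻ c′))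

  assignments-⊆-heights : ∀ {z} → z ∈ map (uncurry assign) candidates⁻ → z ∈ heights
  assignments-⊆-heights z∈ with ∈-map⁻ (uncurry assign) z∈
  ... | (ks , vs) , c∈ , refl with All.lookup candidates⁻-sound c∈
  ... | sat , vs∈ with strictlyDecreasing-sound n (suc t) vs∈
  ... | l , vs<t , dvs = heights-∈ (levels⇒heights S λ j →
          All.lookup (prefixes-profile ks (⊥-profile S) sat)
            (subst (_∈ prefixes ⊥ ks) (∪-identityʳ _)
              (level-assign-∈-prefixes ks vs j (AllPairs.map <⇒≤ dvs) (trans l (sym (saturation-length-⊥ sat))))))
        (assign-≤ ks vs (All.map s≤s⁻¹ vs<t))

  lower-bound : length saturations * length (strictlyDecreasing n (suc t)) ≤ length heights
  lower-bound = subst (_≤ length heights) (trans (length-map (uncurry assign) candidates⁻) (length-cartesianProductWith _,_ saturations _))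
    (Unique-⊆⇒length-≤ (Unique-map⁺ᴾ assign-injective candidates⁻-sound
                          (Unique.cartesianProduct⁺ saturations-unique (strictlyDecreasing-unique n (suc t))))
                       assignments-⊆-heights)

ℤtoℚ≡mkℚ : ∀ a → ℤtoℚ a ≡ mkℚ a 0 (coprime-sym (1-coprimeTo ℤ.∣ a ∣))
ℤtoℚ≡mkℚ (+ k)    = ℚ.normalize-coprime (coprime-sym (1-coprimeTo k))
ℤtoℚ≡mkℚ -[1+ k ] = cong ℚ.-_ (ℚ.normalize-coprime (coprime-sym (1-coprimeTo (suc k))))

ℤtoℚ-+ : ∀ a b → ℤtoℚ (a ℤ.+ b) ≡ ℤtoℚ a ℚ.+ ℤtoℚ b
ℤtoℚ-+ a b rewrite ℤtoℚ≡mkℚ a | ℤtoℚ≡mkℚ b =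
  cong (ℚ._/ 1) (cong₂ ℤ._+_ (sym (ℤ.*-identityʳ a)) (sym (ℤ.*-identityʳ b)))

ℤtoℚ-* : ∀ a b → ℤtoℚ (a ℤ.* b) ≡ ℤtoℚ a ℚ.* ℤtoℚ b
ℤtoℚ-* a b rewrite ℤtoℚ≡mkℚ a | ℤtoℚ≡mkℚ b = refl

ℤtoℚ-neg : ∀ a → ℤtoℚ (ℤ.- a) ≡ ℚ.- ℤtoℚ a
ℤtoℚ-neg a = trans (ℤtoℚ≡mkℚ (ℤ.- a)) (trans (mkℚ-neg a) (cong ℚ.-_ (sym (ℤtoℚ≡mkℚ a))))
  where
  mkℚ-neg : ∀ a → mkℚ (ℤ.- a) 0 (coprime-sym (1-coprimeTo ℤ.∣ ℤ.- a ∣)) ≡ ℚ.- mkℚ a 0 (coprime-sym (1-coprimeTo ℤ.∣ a ∣))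
  mkℚ-neg (+ zero)  = refl
  mkℚ-neg (+ suc k) = refl
  mkℚ-neg -[1+ k ]  = refl

ℤtoℚ-- : ∀ a b → ℤtoℚ (a ℤ.- b) ≡ ℤtoℚ a ℚ.- ℤtoℚ b
ℤtoℚ-- a b = trans (ℤtoℚ-+ a (ℤ.- b)) (cong (λ y → ℤtoℚ a ℚ.+ y) (ℤtoℚ-neg b))

ℤtoℚ-∣∣ : ∀ a → ℤtoℚ (+ ℤ.∣ a ∣) ≡ ℚ.∣ ℤtoℚ a ∣
ℤtoℚ-∣∣ a = trans (ℤtoℚ≡mkℚ (+ ℤ.∣ a ∣)) (trans (mkℚ-∣∣ a) (cong ℚ.∣_∣ (sym (ℤtoℚ≡mkℚ a))))
  where
  mkℚ-∣∣ : ∀ a → mkℚ (+ ℤ.∣ a ∣) 0 (coprime-sym (1-coprimeTo ℤ.∣ + ℤ.∣ a ∣ ∣)) ≡ ℚ.∣ mkℚ a 0 (coprime-sym (1-coprimeTo ℤ.∣ a ∣)) ∣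
  mkℚ-∣∣ (+ k)    = refl
  mkℚ-∣∣ -[1+ k ] = refl

ℤtoℚ-mono-≤ : ∀ {a b} → a ℤ.≤ b → ℤtoℚ a ℚ.≤ ℤtoℚ b
ℤtoℚ-mono-≤ {a} {b} a≤b rewrite ℤtoℚ≡mkℚ a | ℤtoℚ≡mkℚ b =
  *≤* (subst₂ ℤ._≤_ (sym (ℤ.*-identityʳ a)) (sym (ℤ.*-identityʳ b)) a≤b)

ℤtoℚ-cancel-≤ : ∀ {a b} → ℤtoℚ a ℚ.≤ ℤtoℚ b → a ℤ.≤ b
ℤtoℚ-cancel-≤ {a} {b} a≤b rewrite ℤtoℚ≡mkℚ a | ℤtoℚ≡mkℚ b with a≤b
... | *≤* a*1≤b*1 = subst₂ ℤ._≤_ (ℤ.*-identityʳ a) (ℤ.*-identityʳ b) a*1≤b*1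

ℤtoℚ-mono-< : ∀ {a b} → a ℤ.< b → ℤtoℚ a ℚ.< ℤtoℚ b
ℤtoℚ-mono-< {a} {b} a<b rewrite ℤtoℚ≡mkℚ a | ℤtoℚ≡mkℚ b =
  *<* (subst₂ ℤ._<_ (sym (ℤ.*-identityʳ a)) (sym (ℤ.*-identityʳ b)) a<b)

ℕtoℚ-+ : ∀ a b → ℕtoℚ (a ℕ.+ b) ≡ ℕtoℚ a ℚ.+ ℕtoℚ b
ℕtoℚ-+ a b = trans (cong ℤtoℚ (ℤ.pos-+ a b)) (ℤtoℚ-+ (+ a) (+ b))

ℕtoℚ-* : ∀ a b → ℕtoℚ (a ℕ.* b) ≡ ℕtoℚ a ℚ.* ℕtoℚ b
ℕtoℚ-* a b = trans (cong ℤtoℚ (ℤ.pos-* a b)) (ℤtoℚ-* (+ a) (+ b))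

ℕtoℚ-mono-≤ : ∀ {a b} → a ℕ.≤ b → ℕtoℚ a ℚ.≤ ℕtoℚ b
ℕtoℚ-mono-≤ a≤b = ℤtoℚ-mono-≤ (ℤ.+≤+ a≤b)

ℕtoℚ-nonNeg : ∀ a → 0ℚ ℚ.≤ ℕtoℚ a
ℕtoℚ-nonNeg a = ℕtoℚ-mono-≤ (ℕ.z≤n {a})

ℕtoℚ-*-inverse : ∀ k .{{_ : ℕ.NonZero k}} → ℕtoℚ k ℚ.* (+ 1 ℚ./ k) ≡ 1ℚ
ℕtoℚ-*-inverse (suc k) rewrite ℚ.normalize-coprime (1-coprimeTo (suc k)) | ℤtoℚ≡mkℚ (+ suc k) =
  ℚ.fromℚᵘ-cong {mkℚᵘ (+ suc k ℤ.* + 1) (k ℕ.+ 0 ℕ.* suc k)} {mkℚᵘ (+ 1) 0} (ℚᵘ.*≡* (trans (ℤ.*-identityʳ _)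
    (trans (ℤ.*-identityʳ _) (trans (cong (λ y → + suc y) (sym (+-identityʳ k))) (sym (ℤ.*-identityˡ _))))))

1/-nonNeg : ∀ k .{{_ : ℕ.NonZero k}} → 0ℚ ℚ.≤ + 1 ℚ./ k
1/-nonNeg (suc k) rewrite ℚ.normalize-coprime (1-coprimeTo (suc k)) = *≤* (ℤ.+≤+ ℕ.z≤n)

*-monoˡ-≤-ℕtoℚ : ∀ t {a b} → a ℚ.≤ b → ℕtoℚ t ℚ.* a ℚ.≤ ℕtoℚ t ℚ.* b
*-monoˡ-≤-ℕtoℚ t = ℚ.*-monoˡ-≤-nonNeg (ℕtoℚ t) {{ℚ.nonNegative (ℕtoℚ-nonNeg t)}}

sumℚ-map-+ : ∀ {A : Set} (f g : A → ℚ) l → sumℚ (map (λ x → f x ℚ.+ g x) l) ≡ sumℚ (map f l) ℚ.+ sumℚ (map g l)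
sumℚ-map-+ f g []      = sym (ℚ.+-identityʳ 0ℚ)
sumℚ-map-+ f g (x ∷ l) rewrite sumℚ-map-+ f g l = +-interchange (f x) (g x) (sumℚ (map f l)) (sumℚ (map g l))
  where
  +-interchange : ∀ a b c d → (a ℚ.+ b) ℚ.+ (c ℚ.+ d) ≡ (a ℚ.+ c) ℚ.+ (b ℚ.+ d)
  +-interchange a b c d = trans (ℚ.+-assoc a b (c ℚ.+ d)) (trans (cong (λ y → a ℚ.+ y) (trans (sym (ℚ.+-assoc b c d))
    (trans (cong (ℚ._+ d) (ℚ.+-comm b c)) (ℚ.+-assoc c b d)))) (sym (ℚ.+-assoc a c (b ℚ.+ d))))

sumℚ-map-*ʳ : ∀ {A : Set} c (f : A → ℚ) l → sumℚ (map (λ x → f x ℚ.* c) l) ≡ sumℚ (map f l) ℚ.* c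
sumℚ-map-*ʳ c f []      = sym (ℚ.*-zeroˡ c)
sumℚ-map-*ʳ c f (x ∷ l) rewrite sumℚ-map-*ʳ c f l = sym (ℚ.*-distribʳ-+ c (f x) (sumℚ (map f l)))

sumℚ-cong : ∀ {A : Set} {f g : A → ℚ} l → (∀ x → f x ≡ g x) → sumℚ (map f l) ≡ sumℚ (map g l)
sumℚ-cong []      f≗g = refl
sumℚ-cong (x ∷ l) f≗g = cong₂ ℚ._+_ (f≗g x) (sumℚ-cong l f≗g)

sumℚ-mono : ∀ {A : Set} {f g : A → ℚ} {l} → All (λ x → f x ℚ.≤ g x) l → sumℚ (map f l) ℚ.≤ sumℚ (map g l)
sumℚ-mono []           = ℚ.≤-refl
sumℚ-mono (f≤g ∷ f≤gs) = ℚ.+-mono-≤ f≤g (sumℚ-mono f≤gs)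

sumℚ-map-∘ : ∀ {A B : Set} (f : B → ℚ) (g : A → B) l → sumℚ (map f (map g l)) ≡ sumℚ (map (f ∘ g) l)
sumℚ-map-∘ f g l = cong sumℚ (sym (map-∘ l))

sumℚ-applyUpTo : ∀ {A : Set} (h : A → ℚ) (f : ℕ → A) (g : ℕ → ℕ) c t → (∀ j → h (f j) ≡ c ℚ.* ℕtoℚ (g j)) →
                 sumℚ (map h (List.applyUpTo f t)) ≡ c ℚ.* ℕtoℚ (Σ< t g)
sumℚ-applyUpTo h f g c zero    hf≡cg = sym (ℚ.*-zeroʳ c)
sumℚ-applyUpTo h f g c (suc t) hf≡cg = trans (cong₂ ℚ._+_ (hf≡cg 0) (sumℚ-applyUpTo h (f ∘ suc) (g ∘ suc) c t (hf≡cg ∘ suc)))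
  (trans (sym (ℚ.*-distribˡ-+ c _ _)) (cong (c ℚ.*_) (sym (ℕtoℚ-+ (g 0) _))))

module _ {A : Set} (w : List (A × ℚ)) (w≥0 : All (λ p → 0ℚ ℚ.≤ proj₂ p) w) (Σw≡1 : sumℚ (map proj₂ w) ≡ 1ℚ) (f : A → ℚ) (c : ℚ) where

  private
    Σwc≡c : sumℚ (map (λ p → proj₂ p ℚ.* c) w) ≡ c
    Σwc≡c = trans (sumℚ-map-*ʳ c proj₂ w) (trans (cong (ℚ._* c) Σw≡1) (ℚ.*-identityˡ c))

    scale : ∀ {a b : A → ℚ} {ws} → All (λ p → 0ℚ ℚ.≤ proj₂ p) ws → All (λ p → a (proj₁ p) ℚ.≤ b (proj₁ p)) ws →
            All (λ p → proj₂ p ℚ.* a (proj₁ p) ℚ.≤ proj₂ p ℚ.* b (proj₁ p)) ws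
    scale {ws = []}           []         []         = []
    scale {ws = (_ , λ′) ∷ _} (λ≥0 ∷ ws) (a≤b ∷ hs) = ℚ.*-monoˡ-≤-nonNeg λ′ {{ℚ.nonNegative λ≥0}} a≤b ∷ scale ws hs

  convex-≥ : All (λ p → c ℚ.≤ f (proj₁ p)) w → c ℚ.≤ sumℚ (map (λ p → proj₂ p ℚ.* f (proj₁ p)) w)
  convex-≥ c≤f = subst (ℚ._≤ _) Σwc≡c (sumℚ-mono (scale {a = λ _ → c} w≥0 c≤f))

  convex-≤ : All (λ p → f (proj₁ p) ℚ.≤ c) w → sumℚ (map (λ p → proj₂ p ℚ.* f (proj₁ p)) w) ℚ.≤ c
  convex-≤ f≤c = subst (_ ℚ.≤_) Σwc≡c (sumℚ-mono (scale {b = λ _ → c} w≥0 f≤c))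

-- Lattice points of the dilated polytope

-- x_i = t s_i + z_i - z_(i+1) and x_n = z_n, i.e. z_i = x_i + ... + x_n - t ∣ suffix of S ∷ʳ false from i ∣.
toPoint : ∀ {m} → ℕ → Subset m → Vec ℕ (suc m) → Vec ℤ (suc m)
toPoint t []      (z ∷ [])       = + z ∷ []
toPoint t (s ∷ S) (z₁ ∷ z₂ ∷ zs) = (+ (t ℕ.* toℕ s) ℤ.+ + z₁ ℤ.- + z₂) ∷ toPoint t S (z₂ ∷ zs)

toPoint-injective : ∀ {m} t (S : Subset m) {z y} → toPoint t S z ≡ toPoint t S y → z ≡ y
toPoint-injective t []      {_ ∷ []}       {_ ∷ []}       e = cong (_∷ []) (ℤ.+-injective (Vec.∷-injectiveˡ e))
toPoint-injective t (s ∷ S) {z₁ ∷ z₂ ∷ zs} {y₁ ∷ y₂ ∷ ys} e with toPoint-injective t S (Vec.∷-injectiveʳ e)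
... | refl = cong (_∷ z₂ ∷ zs) (ℤ.+-injective (cancel {+ (t ℕ.* toℕ s)} {+ z₁} {+ y₁} {+ z₂} (Vec.∷-injectiveˡ e)))
  where
  open ℤ-Solver
  recover : ∀ a b c → b ≡ a ℤ.+ b ℤ.- c ℤ.+ c ℤ.- a
  recover = solve 3 (λ a b c → b := a :+ b :- c :+ c :- a) refl
  cancel : ∀ {a b b′ c} → a ℤ.+ b ℤ.- c ≡ a ℤ.+ b′ ℤ.- c → b ≡ b′
  cancel {a} {b} {b′} {c} e = trans (recover a b c) (trans (cong (λ x → x ℤ.+ c ℤ.- a) e) (sym (recover a b′ c)))

sumℤ : ∀ {k} → Vec ℤ k → ℤ
sumℤ = Vec.foldr _ ℤ._+_ (+ 0)

sumℤ-toPoint : ∀ {m} t (S : Subset m) z → sumℤ (toPoint t S z) ≡ + (t ℕ.* ∣ S ∷ʳ false ∣) ℤ.+ + head z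
sumℤ-toPoint t []      (z ∷ [])       = trans (ℤ.+-identityʳ (+ z)) (cong (λ a → + a ℤ.+ + z) (sym (*-zeroʳ t)))
sumℤ-toPoint t (s ∷ S) (z₁ ∷ z₂ ∷ zs) = begin
  + a ℤ.+ + z₁ ℤ.- + z₂ ℤ.+ sumℤ (toPoint t S (z₂ ∷ zs)) ≡⟨ cong (λ y → + a ℤ.+ + z₁ ℤ.- + z₂ ℤ.+ y) (sumℤ-toPoint t S (z₂ ∷ zs)) ⟩
  + a ℤ.+ + z₁ ℤ.- + z₂ ℤ.+ (+ c ℤ.+ + z₂)           ≡⟨ solve 4 (λ a z₁ z₂ c → a :+ z₁ :- z₂ :+ (c :+ z₂) := (a :+ c) :+ z₁) refl (+ a) (+ z₁) (+ z₂) (+ c) ⟩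
  + a ℤ.+ + c ℤ.+ + z₁                               ≡⟨ cong (ℤ._+ + z₁) (sym (ℤ.pos-+ a c)) ⟩
  + (a ℕ.+ c) ℤ.+ + z₁                               ≡⟨ cong (λ b → + b ℤ.+ + z₁) (sym (*-distribˡ-+ t (toℕ s) _)) ⟩
  + (t ℕ.* (toℕ s ℕ.+ ∣ S ∷ʳ false ∣)) ℤ.+ + z₁      ≡⟨ cong (λ b → + (t ℕ.* b) ℤ.+ + z₁) (sym (∣∷∣ s (S ∷ʳ false))) ⟩
  + (t ℕ.* ∣ (s ∷ S) ∷ʳ false ∣) ℤ.+ + z₁            ∎
  where
  open ≡-Reasoning
  open ℤ-Solver
  a = t ℕ.* toℕ s
  c = t ℕ.* ∣ S ∷ʳ false ∣

SuffixBounded : ∀ {m} → ℕ → Subset m → Vec ℤ (suc m) → Set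
SuffixBounded t []      (x ∷ [])      = + 0 ℤ.≤ x × x ℤ.≤ + t
SuffixBounded t (s ∷ S) (x₁ ∷ x₂ ∷ xs) =
  (+ 0 ℤ.≤ x₁ × x₁ ℤ.≤ + t) ×
  (+ (t ℕ.* c) ℤ.≤ x₁ ℤ.+ sumℤ (x₂ ∷ xs) × x₁ ℤ.+ sumℤ (x₂ ∷ xs) ℤ.≤ + (t ℕ.* c) ℤ.+ + t) ×
  SuffixBounded t S (x₂ ∷ xs)
  where c = ∣ (s ∷ S) ∷ʳ false ∣

coordinate⇒step : ∀ t s x₁ z₂ → + 0 ℤ.≤ x₁ → x₁ ℤ.≤ + t → (0≤z₁ : + 0 ℤ.≤ x₁ ℤ.+ + z₂ ℤ.- + (t ℕ.* toℕ s)) →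
                  Step ℕ._≤_ s ℤ.∣ x₁ ℤ.+ + z₂ ℤ.- + (t ℕ.* toℕ s) ∣ z₂
coordinate⇒step t true x₁ z₂ _ x₁≤t 0≤z₁ rewrite *-identityʳ t =
  ℤ.drop‿+≤+ (subst₂ ℤ._≤_ (sym (ℤ.0≤i⇒+∣i∣≡i 0≤z₁)) (solve 2 (λ u z → u :+ z :- u := z) refl (+ t) (+ z₂))
                           (ℤ.+-monoˡ-≤ (ℤ.- + t) (ℤ.+-monoˡ-≤ (+ z₂) x₁≤t)))
  where open ℤ-Solver
coordinate⇒step t false x₁ z₂ 0≤x₁ _ 0≤z₁ rewrite *-zeroʳ t =
  ℤ.drop‿+≤+ (subst₂ ℤ._≤_ (solve 1 (λ z → con (+ 0) :+ z := z) refl (+ z₂))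
                           (trans (solve 2 (λ x z → x :+ z := x :+ z :- con (+ 0)) refl x₁ (+ z₂)) (sym (ℤ.0≤i⇒+∣i∣≡i 0≤z₁)))
                           (ℤ.+-monoˡ-≤ (+ z₂) 0≤x₁))
  where open ℤ-Solver

suffixBounded⇒toPoint : ∀ {m} t (S : Subset m) x → SuffixBounded t S x → ∃[ z ] Bounded t z × Heights S z × toPoint t S z ≡ x
suffixBounded⇒toPoint t []      (+ k ∷ []) (_ , +≤+ k≤t) = (k ∷ []) , (λ { zero → k≤t }) , tt , refl
suffixBounded⇒toPoint t (s ∷ S) (x₁ ∷ x₂ ∷ xs) ((0≤x₁ , x₁≤t) , (lo , hi) , sb) with suffixBounded⇒toPoint t S (x₂ ∷ xs) sb
... | z₂ ∷ zs , z≤t , hz , eq = (ℤ.∣ z₁ ∣ ∷ z₂ ∷ zs) , bounded , (coordinate⇒step t s x₁ z₂ 0≤x₁ x₁≤t 0≤z₁ , hz) , cong₂ _∷_ x₁≡ eq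
  where
  open ℤ-Solver
  a = + (t ℕ.* toℕ s)
  c = + (t ℕ.* ∣ S ∷ʳ false ∣)
  z₁ = x₁ ℤ.+ + z₂ ℤ.- a
  suffix : sumℤ (x₂ ∷ xs) ≡ c ℤ.+ + z₂
  suffix = trans (cong sumℤ (sym eq)) (sumℤ-toPoint t S (z₂ ∷ zs))
  tc≡a+c : + (t ℕ.* ∣ (s ∷ S) ∷ʳ false ∣) ≡ a ℤ.+ c
  tc≡a+c = trans (cong (λ b → + (t ℕ.* b)) (∣∷∣ s (S ∷ʳ false))) (trans (cong +_ (*-distribˡ-+ t (toℕ s) _)) (ℤ.pos-+ (t ℕ.* toℕ s) _))
  lo′ : a ℤ.+ c ℤ.≤ x₁ ℤ.+ (c ℤ.+ + z₂)
  lo′ = subst₂ ℤ._≤_ tc≡a+c (cong (λ y → x₁ ℤ.+ y) suffix) lo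
  hi′ : x₁ ℤ.+ (c ℤ.+ + z₂) ℤ.≤ a ℤ.+ c ℤ.+ + t
  hi′ = subst₂ ℤ._≤_ (cong (λ y → x₁ ℤ.+ y) suffix) (cong (ℤ._+ + t) tc≡a+c) hi
  shift : x₁ ℤ.+ (c ℤ.+ + z₂) ℤ.- (a ℤ.+ c) ≡ z₁
  shift = solve 4 (λ x a c z → x :+ (c :+ z) :- (a :+ c) := x :+ z :- a) refl x₁ a c (+ z₂)
  0≤z₁ : + 0 ℤ.≤ z₁
  0≤z₁ = subst (+ 0 ℤ.≤_) shift (ℤ.i≤j⇒0≤j-i lo′)
  z₁≤t : z₁ ℤ.≤ + t
  z₁≤t = subst₂ ℤ._≤_ shift (solve 3 (λ a c u → a :+ c :+ u :- (a :+ c) := u) refl a c (+ t)) (ℤ.+-monoˡ-≤ (ℤ.- (a ℤ.+ c)) hi′)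
  bounded : Bounded t (ℤ.∣ z₁ ∣ ∷ z₂ ∷ zs)
  bounded zero    = ℤ.drop‿+≤+ (subst (ℤ._≤ + t) (sym (ℤ.0≤i⇒+∣i∣≡i 0≤z₁)) z₁≤t)
  bounded (suc i) = z≤t i
  x₁≡ : a ℤ.+ + ℤ.∣ z₁ ∣ ℤ.- + z₂ ≡ x₁
  x₁≡ = trans (cong (λ y → a ℤ.+ y ℤ.- + z₂) (ℤ.0≤i⇒+∣i∣≡i 0≤z₁)) (solve 3 (λ a x z → a :+ (x :+ z :- a) :- z := x) refl a x₁ (+ z₂))

sumVecℚ : ∀ {k} → Vec ℚ k → ℚ
sumVecℚ = Vec.foldr _ ℚ._+_ 0ℚ

IsCombination : ∀ {k} → ℕ → List (Subset k × ℚ) → Vec ℚ k → Set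
IsCombination t w x = ∀ i → lookup x i ≡ ℕtoℚ t ℚ.* sumℚ (map (λ p → proj₂ p ℚ.* eCoord (proj₁ p) i) w)

tailWeights : ∀ {k} → List (Subset (suc k) × ℚ) → List (Subset k × ℚ)
tailWeights = map (Product.map₁ Vec.tail)

IsCombination-tail : ∀ {k} t w {x₀} {x : Vec ℚ k} → IsCombination t w (x₀ ∷ x) → IsCombination t (tailWeights w) x
IsCombination-tail t w comb i = trans (comb (suc i))
  (cong (ℕtoℚ t ℚ.*_) (sym (trans (sumℚ-map-∘ _ _ w) (sumℚ-cong w λ { (_ ∷ _ , _) → refl }))))

eCoord≡toℕ : ∀ {k} (R : Subset k) i → eCoord R i ≡ ℕtoℚ (toℕ (lookup R i))
eCoord≡toℕ R i with lookup R i
... | true  = refl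
... | false = refl

sumVecℚ-combination : ∀ {k} t w (x : Vec ℚ k) → IsCombination t w x →
                      sumVecℚ x ≡ ℕtoℚ t ℚ.* sumℚ (map (λ p → proj₂ p ℚ.* ℕtoℚ ∣ proj₁ p ∣) w)
sumVecℚ-combination t w []       comb = sym (trans (cong (ℕtoℚ t ℚ.*_)
  (trans (sumℚ-cong w λ { ([] , _) → refl }) (trans (sumℚ-map-*ʳ 0ℚ proj₂ w) (ℚ.*-zeroʳ (sumℚ (map proj₂ w))))))
  (ℚ.*-zeroʳ (ℕtoℚ t)))
sumVecℚ-combination t w (x₀ ∷ x) comb = begin
  x₀ ℚ.+ sumVecℚ x
    ≡⟨ cong₂ ℚ._+_ (comb zero) (sumVecℚ-combination t (tailWeights w) x (IsCombination-tail t w comb)) ⟩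
  ℕtoℚ t ℚ.* sumℚ (map (λ p → proj₂ p ℚ.* eCoord (proj₁ p) zero) w) ℚ.+ ℕtoℚ t ℚ.* sumℚ (map (λ p → proj₂ p ℚ.* ℕtoℚ ∣ proj₁ p ∣) (tailWeights w))
    ≡⟨ sym (ℚ.*-distribˡ-+ (ℕtoℚ t) _ _) ⟩
  ℕtoℚ t ℚ.* (sumℚ (map (λ p → proj₂ p ℚ.* eCoord (proj₁ p) zero) w) ℚ.+ sumℚ (map (λ p → proj₂ p ℚ.* ℕtoℚ ∣ proj₁ p ∣) (tailWeights w)))
    ≡⟨ cong (λ y → ℕtoℚ t ℚ.* (sumℚ (map (λ p → proj₂ p ℚ.* eCoord (proj₁ p) zero) w) ℚ.+ y)) (sumℚ-map-∘ _ _ w) ⟩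
  ℕtoℚ t ℚ.* (sumℚ (map (λ p → proj₂ p ℚ.* eCoord (proj₁ p) zero) w) ℚ.+ sumℚ (map (λ p → proj₂ p ℚ.* ℕtoℚ ∣ Vec.tail (proj₁ p) ∣) w))
    ≡⟨ cong (ℕtoℚ t ℚ.*_) (trans (sym (sumℚ-map-+ _ _ w)) (sumℚ-cong w λ { (R , λ′) → head+tail R λ′ })) ⟩
  ℕtoℚ t ℚ.* sumℚ (map (λ p → proj₂ p ℚ.* ℕtoℚ ∣ proj₁ p ∣) w) ∎
  where
  open ≡-Reasoning
  head+tail : ∀ {k} (R : Subset (suc k)) λ′ → λ′ ℚ.* eCoord R zero ℚ.+ λ′ ℚ.* ℕtoℚ ∣ Vec.tail R ∣ ≡ λ′ ℚ.* ℕtoℚ ∣ R ∣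
  head+tail (r ∷ R) λ′ = trans (sym (ℚ.*-distribˡ-+ λ′ _ _)) (cong (λ′ ℚ.*_)
    (trans (cong (ℚ._+ ℕtoℚ ∣ R ∣) (eCoord≡toℕ (r ∷ R) zero)) (trans (sym (ℕtoℚ-+ (toℕ r) ∣ R ∣)) (cong ℕtoℚ (sym (∣∷∣ r R))))))

ConvexCombination : ∀ {m} → Subset m → ℕ → List (Subset (suc m) × ℚ) → Vec ℚ (suc m) → Set
ConvexCombination S t w x = All (λ p → S ∷ʳ false ≼ proj₁ p × proj₁ p ≼ S ∷ʳ true) w
                          × All (λ p → 0ℚ ℚ.≤ proj₂ p) w × sumℚ (map proj₂ w) ≡ 1ℚ × IsCombination t w x

ConvexCombination-tail : ∀ {m} s (S : Subset m) t w {x₀ x} → ConvexCombination (s ∷ S) t w (x₀ ∷ x) →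
                         ConvexCombination S t (tailWeights w) x
ConvexCombination-tail s S t w (in-interval , w≥0 , Σw≡1 , comb) =
  All.map⁺ (All.map (λ { {_ ∷ _ , _} ((_ , S′≼R) , (_ , R≼T′)) → S′≼R , R≼T′ }) in-interval) ,
  All.map⁺ w≥0 , trans (cong sumℚ (sym (map-∘ w))) Σw≡1 , IsCombination-tail t w comb

ConvexCombination-head : ∀ {m} (S : Subset m) t w x → ConvexCombination S t w x →
                         0ℚ ℚ.≤ lookup x zero × lookup x zero ℚ.≤ ℕtoℚ t
ConvexCombination-head S t w x (_ , w≥0 , Σw≡1 , comb) =
  subst₂ ℚ._≤_ (ℚ.*-zeroʳ (ℕtoℚ t)) (sym (comb zero))
    (*-monoˡ-≤-ℕtoℚ t (convex-≥ w w≥0 Σw≡1 (λ R → eCoord R zero) 0ℚ (All.universal (λ p → eCoord-≥0 (proj₁ p)) w))) ,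
  subst₂ ℚ._≤_ (sym (comb zero)) (ℚ.*-identityʳ (ℕtoℚ t))
    (*-monoˡ-≤-ℕtoℚ t (convex-≤ w w≥0 Σw≡1 (λ R → eCoord R zero) 1ℚ (All.universal (λ p → eCoord-≤1 (proj₁ p)) w)))
  where
  eCoord-≥0 : ∀ {k} (R : Subset (suc k)) → 0ℚ ℚ.≤ eCoord R zero
  eCoord-≥0 (true ∷ _)  = ℕtoℚ-nonNeg 1
  eCoord-≥0 (false ∷ _) = ℚ.≤-refl
  eCoord-≤1 : ∀ {k} (R : Subset (suc k)) → eCoord R zero ℚ.≤ 1ℚ
  eCoord-≤1 (true ∷ _)  = ℚ.≤-refl
  eCoord-≤1 (false ∷ _) = ℕtoℚ-nonNeg 1

ConvexCombination-sum : ∀ {m} (S : Subset m) t w x → ConvexCombination S t w x →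
  ℕtoℚ t ℚ.* ℕtoℚ ∣ S ∷ʳ false ∣ ℚ.≤ sumVecℚ x × sumVecℚ x ℚ.≤ ℕtoℚ t ℚ.* (ℕtoℚ ∣ S ∷ʳ false ∣ ℚ.+ 1ℚ)
ConvexCombination-sum S t w x (in-interval , w≥0 , Σw≡1 , comb) =
  subst (_ ℚ.≤_) (sym (sumVecℚ-combination t w x comb)) (*-monoˡ-≤-ℕtoℚ t
    (convex-≥ w w≥0 Σw≡1 (λ R → ℕtoℚ ∣ R ∣) _ (All.map (λ {p} (S′≼R , _) → ℕtoℚ-mono-≤ (≼-∣∣ S′≼R)) in-interval))) ,
  subst (ℚ._≤ _) (sym (sumVecℚ-combination t w x comb)) (*-monoˡ-≤-ℕtoℚ t
    (convex-≤ w w≥0 Σw≡1 (λ R → ℕtoℚ ∣ R ∣) _ (All.map (λ {p} (_ , R≼T′) → upper (≼-∣∣ R≼T′)) in-interval)))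
  where
  c = ∣ S ∷ʳ false ∣
  upper : ∀ {r} → r ℕ.≤ ∣ S ∷ʳ true ∣ → ℕtoℚ r ℚ.≤ ℕtoℚ c ℚ.+ 1ℚ
  upper r≤ = subst (_ ℚ.≤_) (trans (cong ℕtoℚ (trans (∣∷ʳtrue∣ S) (+-comm 1 c))) (ℕtoℚ-+ c 1)) (ℕtoℚ-mono-≤ r≤)

sumVecℚ-map-ℤtoℚ : ∀ {k} (x : Vec ℤ k) → sumVecℚ (Vec.map ℤtoℚ x) ≡ ℤtoℚ (sumℤ x)
sumVecℚ-map-ℤtoℚ []       = refl
sumVecℚ-map-ℤtoℚ (x ∷ xs) = trans (cong (ℤtoℚ x ℚ.+_) (sumVecℚ-map-ℤtoℚ xs)) (sym (ℤtoℚ-+ x (sumℤ xs)))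

convexCombination⇒suffixBounded : ∀ {m} t (S : Subset m) w (x : Vec ℤ (suc m)) →
                                  ConvexCombination S t w (Vec.map ℤtoℚ x) → SuffixBounded t S x
convexCombination⇒suffixBounded t [] w (x ∷ []) cc =
  ℤtoℚ-cancel-≤ (proj₁ hd) , ℤtoℚ-cancel-≤ (proj₂ hd)
  where hd = ConvexCombination-head [] t w (Vec.map ℤtoℚ (x ∷ [])) cc
convexCombination⇒suffixBounded t (s ∷ S) w (x₁ ∷ x₂ ∷ xs) cc =
  (ℤtoℚ-cancel-≤ (proj₁ hd) , ℤtoℚ-cancel-≤ (proj₂ hd)) ,
  (ℤtoℚ-cancel-≤ (subst₂ ℚ._≤_ (sym (ℕtoℚ-* t c)) (sumVecℚ-map-ℤtoℚ (x₁ ∷ x₂ ∷ xs)) (proj₁ sums)) ,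
   ℤtoℚ-cancel-≤ (subst₂ ℚ._≤_ (sumVecℚ-map-ℤtoℚ (x₁ ∷ x₂ ∷ xs)) upper (proj₂ sums))) ,
  convexCombination⇒suffixBounded t S (tailWeights w) (x₂ ∷ xs) (ConvexCombination-tail s S t w cc)
  where
  c = ∣ (s ∷ S) ∷ʳ false ∣
  hd = ConvexCombination-head (s ∷ S) t w (Vec.map ℤtoℚ (x₁ ∷ x₂ ∷ xs)) cc
  sums = ConvexCombination-sum (s ∷ S) t w (Vec.map ℤtoℚ (x₁ ∷ x₂ ∷ xs)) cc
  upper : ℕtoℚ t ℚ.* (ℕtoℚ c ℚ.+ 1ℚ) ≡ ℤtoℚ (+ (t ℕ.* c) ℤ.+ + t)
  upper = trans (ℚ.*-distribˡ-+ (ℕtoℚ t) (ℕtoℚ c) 1ℚ)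
    (trans (cong₂ ℚ._+_ (sym (ℕtoℚ-* t c)) (ℚ.*-identityʳ (ℕtoℚ t))) (sym (ℤtoℚ-+ (+ (t ℕ.* c)) (+ t))))

Σ<-levels≡toPoint : ∀ {m} t (S : Subset m) z i → Heights S z → Bounded t z →
                    + Σ< t (λ j → toℕ (lookup (fromProfile S (level (suc j) z)) i)) ≡ lookup (toPoint t S z) i
Σ<-levels≡toPoint t []      (z₁ ∷ [])      zero    _         z≤t = cong +_ (Σ<-level t z₁ (z≤t zero))
Σ<-levels≡toPoint t (s ∷ S) (z₁ ∷ z₂ ∷ zs) zero    (st , _)  z≤t = begin
  + F                                ≡⟨ solve 2 (λ f z → f := f :+ z :- z) refl (+ F) (+ z₂) ⟩
  + F ℤ.+ + z₂ ℤ.- + z₂              ≡⟨ cong (λ y → y ℤ.- + z₂) (sym (ℤ.pos-+ F z₂)) ⟩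
  + (F ℕ.+ z₂) ℤ.- + z₂              ≡⟨ cong (λ y → + y ℤ.- + z₂) balance ⟩
  + (t ℕ.* toℕ s ℕ.+ z₁) ℤ.- + z₂    ≡⟨ cong (ℤ._- + z₂) (ℤ.pos-+ (t ℕ.* toℕ s) z₁) ⟩
  + (t ℕ.* toℕ s) ℤ.+ + z₁ ℤ.- + z₂  ∎
  where
  open ≡-Reasoning
  open ℤ-Solver
  L : ℕ → Bool
  L j = suc j ℕ.≤ᵇ z₁
  R : ℕ → Bool
  R j = suc j ℕ.≤ᵇ z₂
  F = Σ< t (λ j → toℕ (entry s (L j) (R j)))
  balance : F ℕ.+ z₂ ≡ t ℕ.* toℕ s ℕ.+ z₁
  balance = begin
    F ℕ.+ z₂                                        ≡⟨ cong (F ℕ.+_) (sym (Σ<-level t z₂ (z≤t (suc zero)))) ⟩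
    F ℕ.+ Σ< t (toℕ ∘ R)                             ≡⟨ sym (Σ<-+ t _ _) ⟩
    Σ< t (λ j → toℕ (entry s (L j) (R j)) ℕ.+ toℕ (R j)) ≡⟨ Σ<-cong t (λ j → entry-balance s (Step-map (≤ᵇ-mono (suc j)) s st)) ⟩
    Σ< t (λ j → toℕ s ℕ.+ toℕ (L j))                ≡⟨ Σ<-+ t _ _ ⟩
    Σ< t (λ _ → toℕ s) ℕ.+ Σ< t (toℕ ∘ L)           ≡⟨ cong₂ ℕ._+_ (Σ<-const t (toℕ s)) (Σ<-level t z₁ (z≤t zero)) ⟩
    t ℕ.* toℕ s ℕ.+ z₁                              ∎
Σ<-levels≡toPoint t (s ∷ S) (z₁ ∷ z₂ ∷ zs) (suc i) (_ , hz) z≤t = Σ<-levels≡toPoint t S (z₂ ∷ zs) i hz (z≤t ∘ suc)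

fromProfile-⊥ : ∀ {m} (S : Subset m) → fromProfile S ⊥ ≡ S ∷ʳ false
fromProfile-⊥ []          = refl
fromProfile-⊥ (true ∷ S)  = cong (true ∷_) (fromProfile-⊥ S)
fromProfile-⊥ (false ∷ S) = cong (false ∷_) (fromProfile-⊥ S)

toPoint-0 : ∀ {m} (S : Subset m) z → Bounded 0 z → ∀ i → lookup (toPoint 0 S z) i ≡ + 0
toPoint-0 []      (z ∷ [])       z≤0 zero with z≤0 zero
... | z≤n = refl
toPoint-0 (s ∷ S) (z₁ ∷ z₂ ∷ zs) z≤0 zero with z≤0 zero | z≤0 (suc zero)
... | z≤n | z≤n = refl
toPoint-0 (s ∷ S) (z₁ ∷ z₂ ∷ zs) z≤0 (suc i) = toPoint-0 S (z₂ ∷ zs) (z≤0 ∘ suc) i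

-- The point with height function z is the average of the t level sets of z, dilated by t.
heights⇒inDilate : ∀ {m} (S : Subset m) t {z} → Heights S z → Bounded t z →
                   InDilate (S ∷ʳ false) (S ∷ʳ true) t (Vec.map ℤtoℚ (toPoint t S z))
heights⇒inDilate S zero {z} _ z≤0 =
  (S ∷ʳ false , 1ℚ) ∷ [] , subst (InInterval (S ∷ʳ false) (S ∷ʳ true)) (fromProfile-⊥ S) (profile⇒inInterval S (⊥-profile S)) ∷ [] ,
  ℕtoℚ-nonNeg 1 ∷ [] , ℚ.+-identityʳ 1ℚ ,
  λ i → trans (Vec.lookup-map i ℤtoℚ (toPoint 0 S z)) (trans (cong ℤtoℚ (toPoint-0 S z z≤0 i)) (sym (ℚ.*-zeroˡ (sumℚ (map (λ p → proj₂ p ℚ.* eCoord (proj₁ p) i) ((S ∷ʳ false , 1ℚ) ∷ []))))))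
heights⇒inDilate {m} S t@(suc _) {z} hz z≤t =
  w , All.applyUpTo⁺₂ f t (λ j → profile⇒inInterval S (level-profile S (suc j) hz)) , All.applyUpTo⁺₂ f t (λ _ → 1/-nonNeg t) ,
  Σw≡1 , λ i → sym (coordinate i)
  where
  open ≡-Reasoning
  λ′ = + 1 ℚ./ t
  f : ℕ → Subset (suc m) × ℚ
  f j = fromProfile S (level (suc j) z) , λ′
  w = List.applyUpTo f t
  Σw≡1 : sumℚ (map proj₂ w) ≡ 1ℚ
  Σw≡1 = begin
    sumℚ (map proj₂ w)          ≡⟨ sumℚ-applyUpTo proj₂ f (λ _ → 1) λ′ t (λ _ → sym (ℚ.*-identityʳ λ′)) ⟩
    λ′ ℚ.* ℕtoℚ (Σ< t (λ _ → 1)) ≡⟨ cong (λ y → λ′ ℚ.* ℕtoℚ y) (trans (Σ<-const t 1) (*-identityʳ t)) ⟩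
    λ′ ℚ.* ℕtoℚ t               ≡⟨ ℚ.*-comm λ′ (ℕtoℚ t) ⟩
    ℕtoℚ t ℚ.* λ′               ≡⟨ ℕtoℚ-*-inverse t ⟩
    1ℚ                          ∎
  coordinate : ∀ i → ℕtoℚ t ℚ.* sumℚ (map (λ p → proj₂ p ℚ.* eCoord (proj₁ p) i) w) ≡ lookup (Vec.map ℤtoℚ (toPoint t S z)) i
  coordinate i = begin
    ℕtoℚ t ℚ.* sumℚ (map (λ p → proj₂ p ℚ.* eCoord (proj₁ p) i) w)
      ≡⟨ cong (ℕtoℚ t ℚ.*_) (sumℚ-applyUpTo (λ p → proj₂ p ℚ.* eCoord (proj₁ p) i) f g λ′ t (λ j → cong (λ′ ℚ.*_) (eCoord≡toℕ (fromProfile S (level (suc j) z)) i))) ⟩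
    ℕtoℚ t ℚ.* (λ′ ℚ.* ℕtoℚ (Σ< t g))
      ≡⟨ sym (ℚ.*-assoc (ℕtoℚ t) λ′ (ℕtoℚ (Σ< t g))) ⟩
    ℕtoℚ t ℚ.* λ′ ℚ.* ℕtoℚ (Σ< t g)
      ≡⟨ trans (cong (ℚ._* ℕtoℚ (Σ< t g)) (ℕtoℚ-*-inverse t)) (ℚ.*-identityˡ (ℕtoℚ (Σ< t g))) ⟩
    ℤtoℚ (+ Σ< t g)
      ≡⟨ cong ℤtoℚ (Σ<-levels≡toPoint t S z i hz z≤t) ⟩
    ℤtoℚ (lookup (toPoint t S z) i)
      ≡⟨ sym (Vec.lookup-map i ℤtoℚ (toPoint t S z)) ⟩
    lookup (Vec.map ℤtoℚ (toPoint t S z)) i ∎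
    where
    g : ℕ → ℕ
    g j = toℕ (lookup (fromProfile S (level (suc j) z)) i)

module LatticePoints {m} (S : Subset m) (t : ℕ) where
  open Count S t

  points : List (Vec ℤ (suc m))
  points = map (toPoint t S) heights

  points-sound : ∀ {x} → x ∈ points → InDilate (S ∷ʳ false) (S ∷ʳ true) t (Vec.map ℤtoℚ x)
  points-sound x∈ with ∈-map⁻ (toPoint t S) x∈
  ... | z , z∈ , refl = let hz , z≤t = ∈-heights z∈ in heights⇒inDilate S t hz z≤t

  points-complete : ∀ {x} → InDilate (S ∷ʳ false) (S ∷ʳ true) t (Vec.map ℤtoℚ x) → x ∈ points
  points-complete {x} (w , in-interval , w≥0 , Σw≡1 , comb)
    with suffixBounded⇒toPoint t S x (convexCombination⇒suffixBounded t S w x (≼-interval , w≥0 , Σw≡1 , comb))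
    where
    ≼-interval = All.map (Product.map (Equivalence.to (≤G⇔≼ _ _)) (Equivalence.to (≤G⇔≼ _ _))) in-interval
  ... | z , z≤t , hz , refl = ∈-map⁺ (toPoint t S) (heights-∈ hz z≤t)

  points-enumeration : IsLatticeEnumeration (S ∷ʳ false) (S ∷ʳ true) t points
  points-enumeration = Unique.map⁺ (toPoint-injective t S) heights-unique , λ x → mk⇔ points-sound points-complete

  length-enumeration : ∀ {E} → IsLatticeEnumeration (S ∷ʳ false) (S ∷ʳ true) t E → length E ≡ length heights
  length-enumeration {E} (E-unique , ∈E⇔) = trans
    (≤-antisym (Unique-⊆⇒length-≤ E-unique (points-complete ∘ Equivalence.to (∈E⇔ _)))
               (Unique-⊆⇒length-≤ (proj₁ points-enumeration) (Equivalence.from (∈E⇔ _) ∘ points-sound)))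
    (length-map (toPoint t S) heights)

-- Volume

^-distribʳ-* : ∀ a b k → (a * b) ^ k ≡ a ^ k * b ^ k
^-distribʳ-* a b zero    = refl
^-distribʳ-* a b (suc k) rewrite ^-distribʳ-* a b k =
  solve 4 (λ a b x y → (a :* b) :* (x :* y) := (a :* x) :* (b :* y)) refl a b (a ^ k) (b ^ k)
  where open ℕ-Solver

-- (t+n)ⁿ and (t-m)ⁿ both differ from tⁿ by at most n² (2t)ᵐ, which gives the error term.
count-asymptotics : ∀ m e N t S D → suc m ≤ t → e * S ≤ N → N ≤ e * D →
  suc m ! * D ≤ (t + suc m) ^ suc m → (t ∸ m) ^ suc m ≤ suc m ! * S →
  suc m ! * N ≤ e * t ^ suc m + e * suc m * suc m * 2 ^ m * t ^ m ×
  e * t ^ suc m ≤ suc m ! * N + e * suc m * suc m * 2 ^ m * t ^ m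
count-asymptotics m e N t S D nt lo hi hD hS = up , dn
  where
  open ≤-Reasoning
  open ℕ-Solver
  n = suc m
  f = n !
  R = (t + n) ^ m
  a = t ∸ m
  an : a + n ≡ suc t
  an = trans (+-suc a m) (cong suc (m∸n+n≡m (≤-trans (n≤1+n m) nt)))
  R≤ : R ≤ 2 ^ m * t ^ m
  R≤ = ≤-trans (^-monoˡ-≤ m (≤-trans (+-monoʳ-≤ t nt) (≤-reflexive (solve 1 (λ t → t :+ t := con 2 :* t) refl t)))) (≤-reflexive (^-distribʳ-* 2 t m))
  eR : e * n * n * R ≤ e * n * n * 2 ^ m * t ^ m
  eR = ≤-trans (*-monoʳ-≤ (e * n * n) R≤) (≤-reflexive (sym (*-assoc (e * n * n) (2 ^ m) (t ^ m))))
  up : f * N ≤ e * t ^ n + e * n * n * 2 ^ m * t ^ m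
  up = begin
    f * N ≤⟨ *-monoʳ-≤ f hi ⟩
    f * (e * D) ≡⟨ solve 3 (λ f e D → f :* (e :* D) := e :* (f :* D)) refl f e D ⟩
    e * (f * D) ≤⟨ *-monoʳ-≤ e hD ⟩
    e * (t + n) ^ n ≤⟨ *-monoʳ-≤ e (^-mean-value t n m) ⟩
    e * (t ^ n + n * n * R) ≡⟨ solve 4 (λ e x n R → e :* (x :+ n :* n :* R) := e :* x :+ e :* n :* n :* R) refl e (t ^ n) n R ⟩
    e * t ^ n + e * n * n * R ≤⟨ +-monoʳ-≤ (e * t ^ n) eR ⟩
    e * t ^ n + e * n * n * 2 ^ m * t ^ m ∎
  R2 : (a + n) ^ m ≤ R
  R2 = ^-monoˡ-≤ m (subst (_≤ t + n) (sym an) (subst (_≤ t + n) (+-comm t 1) (+-monoʳ-≤ t (s≤s (z≤n {m})))))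
  dn : e * t ^ n ≤ f * N + e * n * n * 2 ^ m * t ^ m
  dn = begin
    e * t ^ n ≤⟨ *-monoʳ-≤ e (^-monoˡ-≤ n (subst (t ≤_) (sym an) (n≤1+n t))) ⟩
    e * (a + n) ^ n ≤⟨ *-monoʳ-≤ e (^-mean-value a n m) ⟩
    e * (a ^ n + n * n * (a + n) ^ m) ≤⟨ *-monoʳ-≤ e (+-mono-≤ hS (*-monoʳ-≤ (n * n) R2)) ⟩
    e * (f * S + n * n * R) ≡⟨ solve 5 (λ e f S n R → e :* (f :* S :+ n :* n :* R) := f :* (e :* S) :+ e :* n :* n :* R) refl e f S n R ⟩
    f * (e * S) + e * n * n * R ≤⟨ +-mono-≤ (*-monoʳ-≤ f lo) eR ⟩
    f * N + e * n * n * 2 ^ m * t ^ m ∎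

∣+m-+n∣≤ : ∀ a b d → a ≤ b + d → b ≤ a + d → ℤ.∣ + a ℤ.- + b ∣ ≤ d
∣+m-+n∣≤ a b d a≤b+d b≤a+d rewrite ℤ.[+m]-[+n]≡m⊖n a b with ≤-total a b
... | inj₁ a≤b rewrite ℤ.∣⊖∣-≤ a≤b = subst (b ∸ a ≤_) (m+n∸m≡n a d) (∸-monoˡ-≤ a b≤a+d)
... | inj₂ b≤a rewrite ℤ.⊖-≥ b≤a   = subst (a ∸ b ≤_) (m+n∸m≡n b d) (∸-monoˡ-≤ b a≤b+d)

positive⇒1≤∣↥∣ : ∀ ε → 0ℚ ℚ.< ε → 1 ≤ ℤ.∣ ↥ ε ∣
positive⇒1≤∣↥∣ (mkℚ (+ suc p) _ _) _                = s≤s z≤n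
positive⇒1≤∣↥∣ (mkℚ (+ zero)  _ _) (*<* (+<+ ()))
positive⇒1≤∣↥∣ (mkℚ -[1+ p ]  _ _) (*<* ())

<-ε* : ∀ ε → 0ℚ ℚ.< ε → ∀ d M → d * ↧ₙ ε < ℤ.∣ ↥ ε ∣ * M → ℕtoℚ d ℚ.< ε ℚ.* ℕtoℚ M
<-ε* (mkℚ (+ zero)  _ _) (*<* (+<+ ())) d M _
<-ε* (mkℚ -[1+ p ]  _ _) (*<* ())       d M _
<-ε* ε@(mkℚ (+ suc p) q-1 _) _ d M qd<pM =
  ℚ.*-cancelˡ-<-nonNeg (ℕtoℚ q) {{ℚ.nonNegative (ℕtoℚ-nonNeg q)}}
    (subst₂ ℚ._<_ (ℕtoℚ-* q d) qε*M (ℤtoℚ-mono-< (+<+ (subst (_< suc p * M) (*-comm d q) qd<pM))))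
  where
  q = suc q-1
  qε≡p : ℕtoℚ q ℚ.* ε ≡ ℕtoℚ (suc p)
  qε≡p rewrite ℤtoℚ≡mkℚ (+ q) = ℚ.fromℚᵘ-cong {mkℚᵘ (+ q ℤ.* + suc p) (q-1 + 0 * q)} {mkℚᵘ (+ suc p) 0} (ℚᵘ.*≡*
    (trans (ℤ.*-identityʳ (+ q ℤ.* + suc p)) (trans (ℤ.*-comm (+ q) (+ suc p)) (cong (λ y → + suc p ℤ.* + suc y) (sym (+-identityʳ q-1))))))
  qε*M : ℕtoℚ (suc p * M) ≡ ℕtoℚ q ℚ.* (ε ℚ.* ℕtoℚ M)
  qε*M = trans (ℕtoℚ-* (suc p) M) (trans (cong (ℚ._* ℕtoℚ M) (sym qε≡p)) (ℚ.*-assoc (ℕtoℚ q) ε (ℕtoℚ M)))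

module Volume {m} (S : Subset m) where
  open MaximalChains S

  n = suc m
  e = length saturations
  K = e * n * n * 2 ^ m

  v : ℚ
  v = ℕtoℚ e ℚ.* (+ 1 ℚ./ n !) {{n !≢0}}

  v*n!≡e : v ℚ.* ℕtoℚ (n !) ≡ ℕtoℚ e
  v*n!≡e = trans (ℚ.*-assoc (ℕtoℚ e) _ (ℕtoℚ (n !)))
    (trans (cong (ℕtoℚ e ℚ.*_) (trans (ℚ.*-comm _ (ℕtoℚ (n !))) (ℕtoℚ-*-inverse (n !) {{n !≢0}}))) (ℚ.*-identityʳ (ℕtoℚ e)))

  scaled-error : ∀ N t → ℕtoℚ (n !) ℚ.* (ℕtoℚ N ℚ.- v ℚ.* ℕtoℚ (t ^ n)) ≡ ℤtoℚ (+ (n ! * N) ℤ.- + (e * t ^ n))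
  scaled-error N t = begin
    F ℚ.* (X ℚ.+ ℚ.- (v ℚ.* B))              ≡⟨ ℚ.*-distribˡ-+ F X (ℚ.- (v ℚ.* B)) ⟩
    F ℚ.* X ℚ.+ F ℚ.* ℚ.- (v ℚ.* B)          ≡⟨ cong (F ℚ.* X ℚ.+_) (sym (ℚ.neg-distribʳ-* F (v ℚ.* B))) ⟩
    F ℚ.* X ℚ.+ ℚ.- (F ℚ.* (v ℚ.* B))        ≡⟨ cong (λ y → F ℚ.* X ℚ.+ ℚ.- y) (trans (sym (ℚ.*-assoc F v B)) (cong (ℚ._* B) F*v≡e)) ⟩
    F ℚ.* X ℚ.+ ℚ.- (ℕtoℚ e ℚ.* B)          ≡⟨ cong₂ (λ a b → a ℚ.+ ℚ.- b) (sym (ℕtoℚ-* (n !) N)) (sym (ℕtoℚ-* e (t ^ n))) ⟩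
    ℤtoℚ (+ (n ! * N)) ℚ.- ℤtoℚ (+ (e * t ^ n)) ≡⟨ sym (ℤtoℚ-- (+ (n ! * N)) (+ (e * t ^ n))) ⟩
    ℤtoℚ (+ (n ! * N) ℤ.- + (e * t ^ n))      ∎
    where
    open ≡-Reasoning
    F = ℕtoℚ (n !)
    X = ℕtoℚ N
    B = ℕtoℚ (t ^ n)
    F*v≡e : F ℚ.* v ≡ ℕtoℚ e
    F*v≡e = trans (ℚ.*-comm F v) v*n!≡e

  count-error : ∀ t → n ≤ t → ∀ {E} → IsLatticeEnumeration (S ∷ʳ false) (S ∷ʳ true) t E →
                ℤ.∣ + (n ! * length E) ℤ.- + (e * t ^ n) ∣ ≤ K * t ^ m
  count-error t n≤t {E} enum = ∣+m-+n∣≤ _ _ _ (proj₁ bounds) (proj₂ bounds)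
    where
    open Count S t using (heights; lower-bound; upper-bound)
    N = length E
    N≡ : N ≡ length heights
    N≡ = LatticePoints.length-enumeration S t enum
    t∸m+n≡1+t : (t ∸ m) + n ≡ suc t
    t∸m+n≡1+t = trans (+-suc (t ∸ m) m) (cong suc (m∸n+n≡m (≤-trans (n≤1+n m) n≤t)))
    bounds = count-asymptotics m e N t (length (strictlyDecreasing n (suc t))) (length (weaklyDecreasing n (suc t))) n≤t
      (subst (_ ≤_) (sym N≡) lower-bound) (subst (_≤ _) (sym N≡) upper-bound)
      (weaklyDecreasing-count n t)
      (subst (λ b → (t ∸ m) ^ n ≤ n ! * length (strictlyDecreasing n b)) t∸m+n≡1+t (strictlyDecreasing-count n (t ∸ m)))

  module _ (ε : ℚ) (ε>0 : 0ℚ ℚ.< ε) where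

    t₀ = K * ↧ₙ ε + n

    error-small : ∀ t .{{_ : ℕ.NonZero t}} → t₀ ≤ t → K * t ^ m * ↧ₙ ε < ℤ.∣ ↥ ε ∣ * (n ! * t ^ n)
    error-small t t₀≤t = begin-strict
      K * t ^ m * ↧ₙ ε      ≡⟨ solve 3 (λ K x q → K :* x :* q := K :* q :* x) refl K (t ^ m) (↧ₙ ε) ⟩
      K * ↧ₙ ε * t ^ m      <⟨ *-monoˡ-< (t ^ m) {{m^n≢0 t m}} (<-≤-trans (m<m+n (K * ↧ₙ ε) (s≤s z≤n)) t₀≤t) ⟩
      t * t ^ m             ≤⟨ m≤n*m (t ^ n) (n !) {{n !≢0}} ⟩
      n ! * t ^ n           ≤⟨ m≤n*m (n ! * t ^ n) (ℤ.∣ ↥ ε ∣) {{ℕ.>-nonZero (positive⇒1≤∣↥∣ ε ε>0)}} ⟩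
      ℤ.∣ ↥ ε ∣ * (n ! * t ^ n) ∎
      where
      open ≤-Reasoning
      open ℕ-Solver

    count-close : ∀ t → t₀ ≤ t → 1 ≤ t → ∀ E → IsLatticeEnumeration (S ∷ʳ false) (S ∷ʳ true) t E →
                  ℚ.∣ ℕtoℚ (length E) ℚ.- v ℚ.* ℕtoℚ (t ^ n) ∣ ℚ.< ε ℚ.* ℕtoℚ (t ^ n)
    count-close t@(suc t′) t₀≤t _ E enum = ℚ.*-cancelˡ-<-nonNeg F {{ℚ.nonNegative (ℕtoℚ-nonNeg (n !))}}
      (subst₂ ℚ._<_ (sym F*∣error∣) F*ε*tⁿ
        (ℚ.≤-<-trans (ℕtoℚ-mono-≤ (count-error t (≤-trans (m≤n+m n (K * ↧ₙ ε)) t₀≤t) enum))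
                     (<-ε* ε ε>0 (K * t ^ m) (n ! * t ^ n) (error-small t t₀≤t))))
      where
      F = ℕtoℚ (n !)
      error = ℕtoℚ (length E) ℚ.- v ℚ.* ℕtoℚ (t ^ n)
      F*∣error∣ : F ℚ.* ℚ.∣ error ∣ ≡ ℤtoℚ (+ ℤ.∣ + (n ! * length E) ℤ.- + (e * t ^ n) ∣)
      F*∣error∣ = trans (cong (ℚ._* ℚ.∣ error ∣) (sym (ℚ.0≤p⇒∣p∣≡p (ℕtoℚ-nonNeg (n !)))))
        (trans (sym (ℚ.∣p*q∣≡∣p∣*∣q∣ F error)) (trans (cong ℚ.∣_∣ (scaled-error (length E) t)) (sym (ℤtoℚ-∣∣ (+ (n ! * length E) ℤ.- + (e * t ^ n))))))
      F*ε*tⁿ : ε ℚ.* ℕtoℚ (n ! * t ^ n) ≡ F ℚ.* (ε ℚ.* ℕtoℚ (t ^ n))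
      F*ε*tⁿ = trans (cong (ε ℚ.*_) (ℕtoℚ-* (n !) (t ^ n)))
        (trans (sym (ℚ.*-assoc ε F _)) (trans (cong (ℚ._* ℕtoℚ (t ^ n)) (ℚ.*-comm ε F)) (ℚ.*-assoc F ε _)))

  hasVolume : HasVolume n (S ∷ʳ false) (S ∷ʳ true) v
  hasVolume = (λ t → LatticePoints.points S t , LatticePoints.points-enumeration S t) ,
              (λ ε ε>0 → t₀ ε ε>0 , count-close ε ε>0)

proposition5p13 : (m : ℕ) (S₀ : Subset m) →
    ∃[ L ] ∃[ v ] (IsMaxChainEnumeration (S₀ ∷ʳ false) (S₀ ∷ʳ true) L
    × HasVolume (suc m) (S₀ ∷ʳ false) (S₀ ∷ʳ true) v
    × v ℚ.* ℕtoℚ (suc m !) ≡ ℕtoℚ (length L))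
proposition5p13 m S₀ =
  maximalChains , v , maximalChains-enumeration , hasVolume , trans v*n!≡e (cong ℕtoℚ (sym (length-map flag saturations)))
  where
  open MaximalChains S₀
  open Volume S₀
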